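{- Let $\{G_n^*(x)\}$ be a generalized Fibonacci polynomial sequence of Lucas type, and let $m,n$ be positive integers. Then $$\gcd(G_m^*(x),G_n^*(x))=\begin{cases} G^*_{\gcd(m,n)}(x) & \text{if } E_2(m)=E_2(n),\\ \gcd\big(G^*_{\gcd(m,n)}(x),G_0^*(x)\big) & \text{otherwise.}\end{cases}$$
   Context: All polynomials lie in $\mathbb{Z}[x]$ and $\gcd$ denotes the greatest common divisor in $\mathbb{Z}[x]$ (determined up to sign). A generalized Fibonacci polynomial (GFP) sequence $\{G_n(x)\}_{n\ge0}$ is given by $G_0(x)=p_0(x)$, $G_1(x)=p_1(x)$ and $G_n(x)=d(x)G_{n-1}(x)+g(x)G_{n-2}(x)$ for $n\ge 2$, where $p_0(x)$ is a constant and $p_1(x),d(x),g(x)$ are nonzero polynomials in $\mathbb{Z}[x]$ with $\gcd(d(x),g(x))=1$; as in the paper it is assumed that $d(x)^2+4g(x)>0$. Let $a,b$ be the roots of $z^2-d(x)z-g(x)=0$. The sequence is of Lucas type if $p_0\ne 0$, $2p_1(x)=p_0\,d(x)$, $|p_0|\in\{1,2\}$, and $\gcd(p_0,p_1(x))=\gcd(p_0,d(x))=\gcd(p_0,g(x))=1$; then, with $\alpha=2/p_0$, $G_n=(a^n+b^n)/\alpha$, and such a sequence is denoted $G_n^*$. For a positive integer $n$, $E_2(n)$ denotes the largest integer $k$ with $2^k\mid n$. -}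

module Defs where

open import Data.Nat as ℕ using (ℕ; zero; suc; _^_)
open import Data.Nat.Divisibility using () renaming (_∣_ to _∣ℕ_)
open import Data.Nat.GCD using (gcd)
open import Data.Integer as ℤ using (ℤ; +_; ∣_∣)
open import Data.Rational as ℚ using (ℚ; 0ℚ)
open import Data.List using (List; []; _∷_; map; foldr)
open import Data.Product using (Σ; ∃; _×_; _,_)
open import Data.Sum using (_⊎_)
open import Relation.Nullary using (¬_)
open import Relation.Binary.PropositionalEquality using (_≡_)

-- Polynomials in ℤ[x] as coefficient lists (constant term first);
-- trailing zeros allowed, equality is coefficientwise.
Poly : Set
Poly = List ℤ

coeff : Poly → ℕ → ℤ
coeff []       _       = + 0
coeff (a ∷ p)  zero    = a
coeff (a ∷ p)  (suc i) = coeff p i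

infix 4 _≈P_
_≈P_ : Poly → Poly → Set
p ≈P q = ∀ i → coeff p i ≡ coeff q i

const : ℤ → Poly
const c = c ∷ []

infixl 6 _+P_
_+P_ : Poly → Poly → Poly
[]      +P q       = q
(a ∷ p) +P []      = a ∷ p
(a ∷ p) +P (b ∷ q) = (a ℤ.+ b) ∷ (p +P q)

scale : ℤ → Poly → Poly
scale c p = map (c ℤ.*_) p

infixl 7 _*P_
_*P_ : Poly → Poly → Poly
[]      *P q = []
(a ∷ p) *P q = scale a q +P (+ 0 ∷ (p *P q))

NonZeroP : Poly → Set
NonZeroP p = ¬ (p ≈P [])

infix 4 _∣P_
_∣P_ : Poly → Poly → Set
h ∣P p = Σ Poly λ r → r *P h ≈P p

IsGCD : Poly → Poly → Poly → Set
IsGCD g p q = g ∣P p × g ∣P q × (∀ h → h ∣P p → h ∣P q → h ∣P g)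

evalℚ : Poly → ℚ → ℚ
evalℚ p x = foldr (λ c acc → (c ℚ./ 1) ℚ.+ x ℚ.* acc) 0ℚ p

G : ℤ → Poly → Poly → Poly → ℕ → Poly
G p0 p1 d g zero          = const p0
G p0 p1 d g (suc zero)    = p1
G p0 p1 d g (suc (suc n)) = d *P G p0 p1 d g (suc n) +P g *P G p0 p1 d g n

IsE₂ : ℕ → ℕ → Set
IsE₂ n k = (2 ^ k) ∣ℕ n × ¬ ((2 ^ suc k) ∣ℕ n)

SameE₂ : ℕ → ℕ → Set
SameE₂ m n = ∃ λ k → IsE₂ m k × IsE₂ n k

LucasType : ℤ → Poly → Poly → Poly → Set
LucasType p0 p1 d g =
  ¬ (p0 ≡ + 0)
  × (scale (+ 2) p1 ≈P scale p0 d)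
  × (∣ p0 ∣ ≡ 1 ⊎ ∣ p0 ∣ ≡ 2)
  × IsGCD (const (+ 1)) (const p0) p1
  × IsGCD (const (+ 1)) (const p0) d
  × IsGCD (const (+ 1)) (const p0) g

GFPHyp : Poly → Poly → Poly → Set
GFPHyp p1 d g =
  NonZeroP p1 × NonZeroP d × NonZeroP g
  × IsGCD (const (+ 1)) d g
  × (∀ x → 0ℚ ℚ.< evalℚ (d *P d +P scale (+ 4) g) x)

-- With α = 2 / p0 (an integer since ∣p0∣ ∈ {1, 2}) the sequence satisfies the Lucas-type identity
--   α G(n + k) G(n) = G(2n + k) + (−g)ⁿ G(k).
-- A divisor of some G(j + 1) is coprime to g, because G(j + 1) ≡ dʲ p1 modulo g, α p1 = d and gcd(d, g) = 1;
-- for such divisors the identity makes divisibility of G(2r + s) and of G(s) equivalent. Hence replacing the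
-- index pair (2r + s, r) by (s, r), or (2r + s, r + s) by (r + s, s), changes neither the common divisors of
-- the two terms nor the gcd of the indices nor whether their 2-adic valuations agree. This descent ends at
-- (n, n), where both terms equal G(n), or at (0, n), where E₂(0) ≠ E₂(n). Cancelling (−g)ⁿ needs Euclid's
-- lemma in ℤ[x], which comes from Gauss's lemma, the content of a polynomial and pseudo-division.

module Submission where

open import Defs
open import Data.Nat using (ℕ; NonZero)
open import Data.Nat.GCD using (gcd)
open import Data.Integer using (ℤ)
open import Data.Product using (_×_)
open import Relation.Nullary using (¬_)

module Polynomial where

  open import Algebra.Bundles using (CommutativeRing)
  open import Algebra.Structures using (IsCommutativeRing)
  open import Data.Empty using (⊥-elim)
  open import Data.Integer using (+_; -_; -[1+_]; _+_; _*_; _^_; ∣_∣; ≢-nonZero)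
  import Data.Integer.Properties as ℤ
  open import Data.Integer.Divisibility.Signed
    using (divides; ∣ᵤ⇒∣; ∣⇒∣ᵤ; _∣?_; ∣m⇒∣m*n; ∣n⇒∣m*n; ∣m+n∣m⇒∣n; *-monoʳ-∣)
    renaming (_∣_ to _∣ℤ_)
  import Data.Integer.Tactic.RingSolver as ℤ-Solver
  open import Data.List using ([]; _∷_)
  open import Data.List.Relation.Unary.All using (_∷_)
  open import Data.Maybe using (Maybe; just; nothing)
  open import Data.Nat as ℕ using (zero; suc; s≤s; z≤n)
  import Data.Nat.Divisibility as ℕ
  import Data.Nat.Properties as ℕ
  open import Data.Nat.GCD using (gcd[m,n]∣m; gcd[m,n]∣n; gcd-greatest)
  open import Data.Nat.Induction using (<-wellFounded; <-rec)
  open import Data.Nat.Primality using (Prime; euclidsLemma; ¬prime[1]; prime⇒nonTrivial)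
  open import Data.Nat.Primality.Factorisation using (factorise)
  open import Data.Product using (Σ; _,_; proj₁; proj₂)
  open import Data.Sum using (_⊎_; inj₁; inj₂; [_,_]′)
  import Data.Sum as Sum
  open import Induction.WellFounded using (Acc; acc)
  open import Level using (0ℓ)
  open import Relation.Binary using (Setoid; IsEquivalence)
  open import Relation.Binary.PropositionalEquality
  import Relation.Binary.Reasoning.Setoid as SetoidReasoning
  open import Relation.Nullary using (yes; no)
  open import Tactic.RingSolver using (solve-∀)
  import Tactic.RingSolver.Core.AlmostCommutativeRing as ACR

  -- The record wrapper makes both polynomials inferable from an equation.
  infix 4 _≋_
  record _≋_ (p q : Poly) : Set where
    constructor mk≋
    field coeff-≡ : p ≈P q
  open _≋_ public

  ≋-refl : ∀ {p} → p ≋ p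
  ≋-refl = mk≋ λ _ → refl

  ≋-reflexive : ∀ {p q} → p ≡ q → p ≋ q
  ≋-reflexive refl = ≋-refl

  ≋-sym : ∀ {p q} → p ≋ q → q ≋ p
  ≋-sym (mk≋ e) = mk≋ λ i → sym (e i)

  ≋-trans : ∀ {p q r} → p ≋ q → q ≋ r → p ≋ r
  ≋-trans (mk≋ e) (mk≋ f) = mk≋ λ i → trans (e i) (f i)

  ≋-isEquivalence : IsEquivalence _≋_
  ≋-isEquivalence = record { refl = ≋-refl ; sym = ≋-sym ; trans = ≋-trans }

  ≋-setoid : Setoid 0ℓ 0ℓ
  ≋-setoid = record { isEquivalence = ≋-isEquivalence }

  module ≋-Reasoning = SetoidReasoning ≋-setoid

  coeff-+P : ∀ p q i → coeff (p +P q) i ≡ coeff p i + coeff q i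
  coeff-+P []      q       i       = sym (ℤ.+-identityˡ _)
  coeff-+P (a ∷ p) []      i       = sym (ℤ.+-identityʳ _)
  coeff-+P (a ∷ p) (b ∷ q) zero    = refl
  coeff-+P (a ∷ p) (b ∷ q) (suc i) = coeff-+P p q i

  coeff-scale : ∀ c p i → coeff (scale c p) i ≡ c * coeff p i
  coeff-scale c []      i       = sym (ℤ.*-zeroʳ c)
  coeff-scale c (a ∷ p) zero    = refl
  coeff-scale c (a ∷ p) (suc i) = coeff-scale c p i

  ∷-cong : ∀ {a b p q} → a ≡ b → p ≋ q → a ∷ p ≋ b ∷ q
  ∷-cong a≡b (mk≋ e) = mk≋ λ { zero → a≡b ; (suc i) → e i }

  ∷-injectiveˡ : ∀ {a b p q} → a ∷ p ≋ b ∷ q → a ≡ b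
  ∷-injectiveˡ (mk≋ e) = e zero

  ∷-injectiveʳ : ∀ {a b p q} → a ∷ p ≋ b ∷ q → p ≋ q
  ∷-injectiveʳ (mk≋ e) = mk≋ λ i → e (suc i)

  +P-cong : ∀ {p p′ q q′} → p ≋ p′ → q ≋ q′ → p +P q ≋ p′ +P q′
  +P-cong {p} {p′} {q} {q′} (mk≋ e) (mk≋ f) = mk≋ λ i → begin
    coeff (p +P q) i        ≡⟨ coeff-+P p q i ⟩
    coeff p i + coeff q i   ≡⟨ cong₂ _+_ (e i) (f i) ⟩
    coeff p′ i + coeff q′ i ≡⟨ coeff-+P p′ q′ i ⟨
    coeff (p′ +P q′) i      ∎
    where open ≡-Reasoning

  scale-cong : ∀ c {p q} → p ≋ q → scale c p ≋ scale c q
  scale-cong c {p} {q} (mk≋ e) = mk≋ λ i →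
    trans (coeff-scale c p i) (trans (cong (c *_) (e i)) (sym (coeff-scale c q i)))

  scale-congˡ : ∀ {c d} p → c ≡ d → scale c p ≋ scale d p
  scale-congˡ p refl = ≋-refl

  +P-comm : ∀ p q → p +P q ≋ q +P p
  +P-comm p q = mk≋ λ i →
    trans (coeff-+P p q i) (trans (ℤ.+-comm (coeff p i) (coeff q i)) (sym (coeff-+P q p i)))

  +P-assoc : ∀ p q r → (p +P q) +P r ≋ p +P (q +P r)
  +P-assoc p q r = mk≋ λ i → begin
    coeff ((p +P q) +P r) i               ≡⟨ coeff-+P (p +P q) r i ⟩
    coeff (p +P q) i + coeff r i          ≡⟨ cong (_+ coeff r i) (coeff-+P p q i) ⟩
    coeff p i + coeff q i + coeff r i     ≡⟨ ℤ.+-assoc (coeff p i) (coeff q i) (coeff r i) ⟩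
    coeff p i + (coeff q i + coeff r i)   ≡⟨ cong (_+_ (coeff p i)) (coeff-+P q r i) ⟨
    coeff p i + coeff (q +P r) i          ≡⟨ coeff-+P p (q +P r) i ⟨
    coeff (p +P (q +P r)) i               ∎
    where open ≡-Reasoning

  +P-identityʳ : ∀ p → p +P [] ≋ p
  +P-identityʳ []      = ≋-refl
  +P-identityʳ (a ∷ p) = ≋-refl

  +P-middle-swap : ∀ w x y z → (w +P x) +P (y +P z) ≋ (w +P y) +P (x +P z)
  +P-middle-swap w x y z = begin
    (w +P x) +P (y +P z) ≈⟨ +P-assoc w x (y +P z) ⟩
    w +P (x +P (y +P z)) ≈⟨ +P-cong (≋-refl {w}) (≋-sym (+P-assoc x y z)) ⟩
    w +P ((x +P y) +P z) ≈⟨ +P-cong (≋-refl {w}) (+P-cong (+P-comm x y) ≋-refl) ⟩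
    w +P ((y +P x) +P z) ≈⟨ +P-cong (≋-refl {w}) (+P-assoc y x z) ⟩
    w +P (y +P (x +P z)) ≈⟨ +P-assoc w y (x +P z) ⟨
    (w +P y) +P (x +P z) ∎
    where open ≋-Reasoning

  -P_ : Poly → Poly
  -P p = scale (- + 1) p

  -P-cong : ∀ {p q} → p ≋ q → -P p ≋ -P q
  -P-cong = scale-cong (- + 1)

  +P-inverseʳ : ∀ p → p +P -P p ≋ []
  +P-inverseʳ p = mk≋ λ i → begin
    coeff (p +P -P p) i                 ≡⟨ coeff-+P p (-P p) i ⟩
    coeff p i + coeff (-P p) i          ≡⟨ cong (_+_ (coeff p i)) (coeff-scale (- + 1) p i) ⟩
    coeff p i + - + 1 * coeff p i       ≡⟨ cong (_+_ (coeff p i)) (ℤ.-1*i≡-i (coeff p i)) ⟩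
    coeff p i + - coeff p i             ≡⟨ ℤ.+-inverseʳ (coeff p i) ⟩
    + 0                                 ∎
    where open ≡-Reasoning

  scale-distrib-+P : ∀ c p q → scale c (p +P q) ≋ scale c p +P scale c q
  scale-distrib-+P c p q = mk≋ λ i → begin
    coeff (scale c (p +P q)) i                ≡⟨ coeff-scale c (p +P q) i ⟩
    c * coeff (p +P q) i                      ≡⟨ cong (c *_) (coeff-+P p q i) ⟩
    c * (coeff p i + coeff q i)               ≡⟨ ℤ.*-distribˡ-+ c (coeff p i) (coeff q i) ⟩
    c * coeff p i + c * coeff q i             ≡⟨ cong₂ _+_ (coeff-scale c p i) (coeff-scale c q i) ⟨
    coeff (scale c p) i + coeff (scale c q) i ≡⟨ coeff-+P (scale c p) (scale c q) i ⟨
    coeff (scale c p +P scale c q) i          ∎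
    where open ≡-Reasoning

  scale-distribʳ-+ : ∀ c d p → scale (c + d) p ≋ scale c p +P scale d p
  scale-distribʳ-+ c d p = mk≋ λ i → begin
    coeff (scale (c + d) p) i                 ≡⟨ coeff-scale (c + d) p i ⟩
    (c + d) * coeff p i                       ≡⟨ ℤ.*-distribʳ-+ (coeff p i) c d ⟩
    c * coeff p i + d * coeff p i             ≡⟨ cong₂ _+_ (coeff-scale c p i) (coeff-scale d p i) ⟨
    coeff (scale c p) i + coeff (scale d p) i ≡⟨ coeff-+P (scale c p) (scale d p) i ⟨
    coeff (scale c p +P scale d p) i          ∎
    where open ≡-Reasoning

  scale-scale : ∀ c d p → scale c (scale d p) ≋ scale (c * d) p
  scale-scale c d p = mk≋ λ i → begin
    coeff (scale c (scale d p)) i ≡⟨ coeff-scale c (scale d p) i ⟩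
    c * coeff (scale d p) i       ≡⟨ cong (c *_) (coeff-scale d p i) ⟩
    c * (d * coeff p i)           ≡⟨ ℤ.*-assoc c d (coeff p i) ⟨
    c * d * coeff p i             ≡⟨ coeff-scale (c * d) p i ⟨
    coeff (scale (c * d) p) i     ∎
    where open ≡-Reasoning

  scale-identity : ∀ p → scale (+ 1) p ≋ p
  scale-identity p = mk≋ λ i → trans (coeff-scale (+ 1) p i) (ℤ.*-identityˡ (coeff p i))

  scale-zero : ∀ p → scale (+ 0) p ≋ []
  scale-zero p = mk≋ λ i → trans (coeff-scale (+ 0) p i) (ℤ.*-zeroˡ (coeff p i))

  *P-zeroˡ : ∀ {p} q → p ≋ [] → p *P q ≋ []
  *P-zeroˡ {[]}    q p≋0 = ≋-refl
  *P-zeroˡ {a ∷ p} q p≋0 = begin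
    scale a q +P (+ 0 ∷ p *P q)      ≈⟨ +P-cong (scale-congˡ q (coeff-≡ p≋0 zero)) (∷-cong refl (*P-zeroˡ {p} q (mk≋ λ i → coeff-≡ p≋0 (suc i)))) ⟩
    scale (+ 0) q +P (+ 0 ∷ [])      ≈⟨ +P-cong (scale-zero q) ≋-refl ⟩
    + 0 ∷ []                         ≈⟨ mk≋ (λ { zero → refl ; (suc i) → refl }) ⟩
    []                               ∎
    where open ≋-Reasoning

  *P-zeroʳ : ∀ p → p *P [] ≋ []
  *P-zeroʳ []      = ≋-refl
  *P-zeroʳ (a ∷ p) = mk≋ λ { zero → refl ; (suc i) → coeff-≡ (*P-zeroʳ p) i }

  *P-congˡ : ∀ {p p′} q → p ≋ p′ → p *P q ≋ p′ *P q
  *P-congˡ {[]}    q e = ≋-sym (*P-zeroˡ q (≋-sym e))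
  *P-congˡ {a ∷ p} {[]} q e = *P-zeroˡ q e
  *P-congˡ {a ∷ p} {b ∷ p′} q e =
    +P-cong (scale-congˡ q (∷-injectiveˡ e)) (∷-cong refl (*P-congˡ q (∷-injectiveʳ e)))

  *P-congʳ : ∀ p {q q′} → q ≋ q′ → p *P q ≋ p *P q′
  *P-congʳ []      e = ≋-refl
  *P-congʳ (a ∷ p) e = +P-cong (scale-cong a e) (∷-cong refl (*P-congʳ p e))

  *P-cong : ∀ {p p′ q q′} → p ≋ p′ → q ≋ q′ → p *P q ≋ p′ *P q′
  *P-cong {p′ = p′} {q} e f = ≋-trans (*P-congˡ q e) (*P-congʳ p′ f)

  *P-distribʳ-+P : ∀ p q r → (p +P q) *P r ≋ p *P r +P q *P r
  *P-distribʳ-+P []      q       r = ≋-refl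
  *P-distribʳ-+P (a ∷ p) []      r = ≋-sym (+P-identityʳ _)
  *P-distribʳ-+P (a ∷ p) (b ∷ q) r = begin
    scale (a + b) r +P (+ 0 ∷ (p +P q) *P r)
      ≈⟨ +P-cong (scale-distribʳ-+ a b r) (∷-cong refl (*P-distribʳ-+P p q r)) ⟩
    (scale a r +P scale b r) +P (+ 0 ∷ (p *P r +P q *P r))
      ≈⟨ +P-middle-swap (scale a r) (scale b r) (+ 0 ∷ p *P r) (+ 0 ∷ q *P r) ⟩
    (scale a r +P (+ 0 ∷ p *P r)) +P (scale b r +P (+ 0 ∷ q *P r)) ∎
    where open ≋-Reasoning

  *P-distribˡ-+P : ∀ p q r → p *P (q +P r) ≋ p *P q +P p *P r
  *P-distribˡ-+P []      q r = ≋-refl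
  *P-distribˡ-+P (a ∷ p) q r = begin
    scale a (q +P r) +P (+ 0 ∷ p *P (q +P r))
      ≈⟨ +P-cong (scale-distrib-+P a q r) (∷-cong refl (*P-distribˡ-+P p q r)) ⟩
    (scale a q +P scale a r) +P (+ 0 ∷ (p *P q +P p *P r))
      ≈⟨ +P-middle-swap (scale a q) (scale a r) (+ 0 ∷ p *P q) (+ 0 ∷ p *P r) ⟩
    (scale a q +P (+ 0 ∷ p *P q)) +P (scale a r +P (+ 0 ∷ p *P r)) ∎
    where open ≋-Reasoning

  shift-*P : ∀ p q → (+ 0 ∷ p) *P q ≋ + 0 ∷ p *P q
  shift-*P p q = +P-cong (scale-zero q) ≋-refl

  scale-*P : ∀ c p q → scale c p *P q ≋ scale c (p *P q)
  scale-*P c []      q = ≋-refl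
  scale-*P c (a ∷ p) q = begin
    scale (c * a) q +P (+ 0 ∷ scale c p *P q)
      ≈⟨ +P-cong (≋-sym (scale-scale c a q)) (∷-cong (sym (ℤ.*-zeroʳ c)) (scale-*P c p q)) ⟩
    scale c (scale a q) +P scale c (+ 0 ∷ p *P q)
      ≈⟨ scale-distrib-+P c (scale a q) (+ 0 ∷ p *P q) ⟨
    scale c (scale a q +P (+ 0 ∷ p *P q)) ∎
    where open ≋-Reasoning

  *P-assoc : ∀ p q r → (p *P q) *P r ≋ p *P (q *P r)
  *P-assoc []      q r = ≋-refl
  *P-assoc (a ∷ p) q r = begin
    (scale a q +P (+ 0 ∷ p *P q)) *P r        ≈⟨ *P-distribʳ-+P (scale a q) (+ 0 ∷ p *P q) r ⟩
    scale a q *P r +P (+ 0 ∷ p *P q) *P r     ≈⟨ +P-cong (scale-*P a q r) (shift-*P (p *P q) r) ⟩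
    scale a (q *P r) +P (+ 0 ∷ (p *P q) *P r) ≈⟨ +P-cong ≋-refl (∷-cong refl (*P-assoc p q r)) ⟩
    scale a (q *P r) +P (+ 0 ∷ p *P (q *P r)) ∎
    where open ≋-Reasoning

  *P-∷ : ∀ q a p → q *P (a ∷ p) ≋ scale a q +P (+ 0 ∷ q *P p)
  *P-∷ []      a p = mk≋ λ { zero → refl ; (suc i) → refl }
  *P-∷ (b ∷ q) a p = begin
    (b * a ∷ scale b p) +P (+ 0 ∷ q *P (a ∷ p))
      ≈⟨ +P-cong (≋-refl {b * a ∷ scale b p}) (∷-cong refl (*P-∷ q a p)) ⟩
    (b * a ∷ scale b p) +P (+ 0 ∷ (scale a q +P (+ 0 ∷ q *P p)))
      ≈⟨ ∷-cong (cong (_+ + 0) (ℤ.*-comm b a)) (begin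
           scale b p +P (scale a q +P (+ 0 ∷ q *P p)) ≈⟨ +P-assoc (scale b p) (scale a q) _ ⟨
           (scale b p +P scale a q) +P (+ 0 ∷ q *P p) ≈⟨ +P-cong (+P-comm (scale b p) (scale a q)) ≋-refl ⟩
           (scale a q +P scale b p) +P (+ 0 ∷ q *P p) ≈⟨ +P-assoc (scale a q) (scale b p) _ ⟩
           scale a q +P (scale b p +P (+ 0 ∷ q *P p)) ∎) ⟩
    (a * b ∷ scale a q) +P (+ 0 ∷ (scale b p +P (+ 0 ∷ q *P p))) ∎
    where open ≋-Reasoning

  *P-comm : ∀ p q → p *P q ≋ q *P p
  *P-comm []      q = ≋-sym (*P-zeroʳ q)
  *P-comm (a ∷ p) q = ≋-trans (+P-cong ≋-refl (∷-cong refl (*P-comm p q))) (≋-sym (*P-∷ q a p))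

  const-*P : ∀ c p → const c *P p ≋ scale c p
  const-*P c p = +P-identityʳ′ (scale c p)
    where
    +P-identityʳ′ : ∀ x → x +P (+ 0 ∷ []) ≋ x
    +P-identityʳ′ x = mk≋ λ i → trans (coeff-+P x (+ 0 ∷ []) i) (trans (cong (_+_ (coeff x i)) (zero-coeff i)) (ℤ.+-identityʳ _))
      where
      zero-coeff : ∀ i → coeff (+ 0 ∷ []) i ≡ + 0
      zero-coeff zero    = refl
      zero-coeff (suc i) = refl

  1P : Poly
  1P = const (+ 1)

  *P-identityˡ : ∀ p → 1P *P p ≋ p
  *P-identityˡ p = ≋-trans (const-*P (+ 1) p) (scale-identity p)

  -- Abstract so that the ring solver does not unfold the proofs of the laws, which is very slow.
  abstract
    ℤ[x]-isCommutativeRing : IsCommutativeRing _≋_ _+P_ _*P_ -P_ [] 1P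
    ℤ[x]-isCommutativeRing = record
      { isRing = record
        { +-isAbelianGroup = record
          { isGroup = record
            { isMonoid = record
              { isSemigroup = record
                { isMagma = record { isEquivalence = ≋-isEquivalence ; ∙-cong = +P-cong }
                ; assoc = +P-assoc }
              ; identity = (λ _ → ≋-refl) , +P-identityʳ }
            ; inverse = (λ p → ≋-trans (+P-comm (-P p) p) (+P-inverseʳ p)) , +P-inverseʳ
            ; ⁻¹-cong = -P-cong }
          ; comm = +P-comm }
        ; *-cong = *P-cong
        ; *-assoc = *P-assoc
        ; *-identity = *P-identityˡ , (λ p → ≋-trans (*P-comm p 1P) (*P-identityˡ p))
        ; distrib = *P-distribˡ-+P , (λ p q r → *P-distribʳ-+P q r p) }
      ; *-comm = *P-comm }

  ℤ[x] : CommutativeRing 0ℓ 0ℓ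
  ℤ[x] = record { isCommutativeRing = ℤ[x]-isCommutativeRing }

  ℤ[x]-almost : ACR.AlmostCommutativeRing 0ℓ 0ℓ
  ℤ[x]-almost = ACR.fromCommutativeRing ℤ[x] []≟_
    where
    []≟_ : ∀ p → Maybe ([] ≋ p)
    []≟ []      = just ≋-refl
    []≟ (a ∷ p) with a ℤ.≟ + 0 | []≟ p
    ... | yes refl | just e = just (mk≋ λ { zero → refl ; (suc i) → coeff-≡ e i })
    ... | _        | _      = nothing

  infix 4 _∣_
  _∣_ : Poly → Poly → Set
  h ∣ p = Σ Poly λ r → r *P h ≋ p

  ∣P⇒∣ : ∀ {h p} → h ∣P p → h ∣ p
  ∣P⇒∣ (r , e) = r , mk≋ e

  ∣⇒∣P : ∀ {h p} → h ∣ p → h ∣P p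
  ∣⇒∣P (r , e) = r , coeff-≡ e

  ∣-refl : ∀ h → h ∣ h
  ∣-refl h = 1P , *P-identityˡ h

  ∣-respʳ : ∀ {h p q} → p ≋ q → h ∣ p → h ∣ q
  ∣-respʳ p≋q (r , e) = r , ≋-trans e p≋q

  ∣-trans : ∀ {f g h} → f ∣ g → g ∣ h → f ∣ h
  ∣-trans {f} (r , e) (s , e′) = s *P r , ≋-trans (*P-assoc s r f) (≋-trans (*P-congʳ s e) e′)

  ∣-*P-left : ∀ {h p} q → h ∣ p → h ∣ q *P p
  ∣-*P-left {h} q (r , e) = q *P r , ≋-trans (*P-assoc q r h) (*P-congʳ q e)

  ∣-*P-right : ∀ {h p} q → h ∣ p → h ∣ p *P q
  ∣-*P-right {p = p} q h∣p = ∣-respʳ (*P-comm q p) (∣-*P-left q h∣p)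

  ∣-factor : ∀ h q → h ∣ q *P h
  ∣-factor h q = q , ≋-refl

  ∣-+P : ∀ {h p q} → h ∣ p → h ∣ q → h ∣ p +P q
  ∣-+P {h} (r , e) (s , f) = r +P s , ≋-trans (*P-distribʳ-+P r s h) (+P-cong e f)

  ∣-scale : ∀ {h p} c → h ∣ p → h ∣ scale c p
  ∣-scale {p = p} c h∣p = ∣-respʳ (const-*P c p) (∣-*P-left (const c) h∣p)

  ∣-+P-cancelˡ : ∀ {h p q} → h ∣ p +P q → h ∣ p → h ∣ q
  ∣-+P-cancelˡ {p = p} {q} h∣p+q h∣p = ∣-respʳ p+q-p≋q (∣-+P h∣p+q (∣-scale (- + 1) h∣p))
    where
    p+q-p≋q : (p +P q) +P -P p ≋ q
    p+q-p≋q = cancel p q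
      where
      cancel : ∀ p q → (p +P q) +P -P p ≋ q
      cancel = solve-∀ ℤ[x]-almost

  ∣-+P-cancelʳ : ∀ {h p q} → h ∣ p +P q → h ∣ q → h ∣ p
  ∣-+P-cancelʳ {p = p} {q} h∣p+q = ∣-+P-cancelˡ (∣-respʳ (+P-comm p q) h∣p+q)

  ∣1P⇒∣ : ∀ {h} p → h ∣ 1P → h ∣ p
  ∣1P⇒∣ p h∣1 = ∣-trans h∣1 (p , ≋-trans (*P-comm p 1P) (*P-identityˡ p))

  ∷≋[]-head : ∀ {a p} → a ∷ p ≋ [] → a ≡ + 0
  ∷≋[]-head e = coeff-≡ e zero

  ∷≋[]-tail : ∀ {a p} → a ∷ p ≋ [] → p ≋ []
  ∷≋[]-tail e = mk≋ λ i → coeff-≡ e (suc i)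

  0∷≋[] : ∀ {p} → p ≋ [] → + 0 ∷ p ≋ []
  0∷≋[] e = mk≋ λ { zero → refl ; (suc i) → coeff-≡ e i }

  *P-zero-divisor : ∀ p q → p *P q ≋ [] → p ≋ [] ⊎ q ≋ []
  *P-zero-divisor []      q _ = inj₁ ≋-refl
  *P-zero-divisor (a ∷ p) q e with a ℤ.≟ + 0
  ... | yes refl = Sum.map₁ 0∷≋[] (*P-zero-divisor p q (∷≋[]-tail (≋-trans (≋-sym (shift-*P p q)) e)))
  ... | no a≢0   = inj₂ (unit-head {p = p} a≢0 q e)
    where
    unit-head : ∀ {a p} → a ≢ + 0 → ∀ q → (a ∷ p) *P q ≋ [] → q ≋ []
    unit-head         a≢0 []      _ = ≋-refl
    unit-head {a} {p} a≢0 (b ∷ q) e with b ℤ.≟ + 0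
    ... | yes refl = 0∷≋[] (unit-head {p = p} a≢0 q (∷≋[]-tail (begin
      + 0 ∷ (a ∷ p) *P q     ≈⟨ ∷-cong refl (*P-comm (a ∷ p) q) ⟩
      + 0 ∷ q *P (a ∷ p)     ≈⟨ shift-*P q (a ∷ p) ⟨
      (+ 0 ∷ q) *P (a ∷ p)   ≈⟨ *P-comm (+ 0 ∷ q) (a ∷ p) ⟩
      (a ∷ p) *P (+ 0 ∷ q)   ≈⟨ e ⟩
      []                     ∎)))
      where open ≋-Reasoning
    ... | no b≢0 =
      ⊥-elim ([ a≢0 , b≢0 ]′ (ℤ.i*j≡0⇒i≡0∨j≡0 a (trans (sym (ℤ.+-identityʳ (a * b))) (∷≋[]-head e))))

  *P-cancelʳ : ∀ {p q} r → ¬ r ≋ [] → p *P r ≋ q *P r → p ≋ q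
  *P-cancelʳ {p} {q} r r≢0 e with *P-zero-divisor (p +P -P q) r difference*r≋0
    where
    difference*r≋0 : (p +P -P q) *P r ≋ []
    difference*r≋0 = begin
      (p +P -P q) *P r         ≈⟨ *P-distribʳ-difference p q r ⟩
      p *P r +P -P (q *P r)    ≈⟨ +P-cong e ≋-refl ⟩
      q *P r +P -P (q *P r)    ≈⟨ +P-inverseʳ (q *P r) ⟩
      []                       ∎
      where
      open ≋-Reasoning
      *P-distribʳ-difference : ∀ p q r → (p +P -P q) *P r ≋ p *P r +P -P (q *P r)
      *P-distribʳ-difference = solve-∀ ℤ[x]-almost
  ... | inj₂ r≋0 = ⊥-elim (r≢0 r≋0)
  ... | inj₁ p-q≋0 = begin
    p                       ≈⟨ difference-+P p q ⟩
    (p +P -P q) +P q        ≈⟨ +P-cong p-q≋0 ≋-refl ⟩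
    q                       ∎
    where
    open ≋-Reasoning
    difference-+P : ∀ p q → p ≋ (p +P -P q) +P q
    difference-+P = solve-∀ ℤ[x]-almost

  scale-cancel : ∀ {p q} c → c ≢ + 0 → scale c p ≋ scale c q → p ≋ q
  scale-cancel {p} {q} c c≢0 e = mk≋ λ i → ℤ.*-cancelˡ-≡ c (coeff p i) (coeff q i) {{≢-nonZero c≢0}}
    (trans (sym (coeff-scale c p i)) (trans (coeff-≡ e i) (coeff-scale c q i)))

  infix 4 _∣ᶜ_
  _∣ᶜ_ : ℤ → Poly → Set
  c ∣ᶜ p = ∀ i → c ∣ℤ coeff p i

  ∣ᶜ-[] : ∀ c → c ∣ᶜ []
  ∣ᶜ-[] c _ = divides (+ 0) refl

  ∣ᶜ-∷ : ∀ {c a p} → c ∣ℤ a → c ∣ᶜ p → c ∣ᶜ a ∷ p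
  ∣ᶜ-∷ c∣a c∣p zero    = c∣a
  ∣ᶜ-∷ c∣a c∣p (suc i) = c∣p i

  ∣ᶜ-resp : ∀ {c p q} → p ≋ q → c ∣ᶜ p → c ∣ᶜ q
  ∣ᶜ-resp {c} p≋q c∣p i = subst (c ∣ℤ_) (coeff-≡ p≋q i) (c∣p i)

  ∣ᶜ-scale : ∀ c p → c ∣ᶜ scale c p
  ∣ᶜ-scale c p i = divides (coeff p i) (trans (coeff-scale c p i) (ℤ.*-comm c (coeff p i)))

  ∣ᶜ⇒scale : ∀ c p → c ∣ᶜ p → Σ Poly λ p′ → p ≋ scale c p′
  ∣ᶜ⇒scale c []      _   = [] , ≋-refl
  ∣ᶜ⇒scale c (a ∷ p) c∣p with c∣p zero | ∣ᶜ⇒scale c p (λ i → c∣p (suc i))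
  ... | divides a′ a≡a′c | p′ , p≋cp′ = a′ ∷ p′ , ∷-cong (trans a≡a′c (ℤ.*-comm a′ c)) p≋cp′

  ∣ᶜ-*P-left : ∀ {c p} q → c ∣ᶜ p → c ∣ᶜ q *P p
  ∣ᶜ-*P-left {c} {p} q c∣p with ∣ᶜ⇒scale c p c∣p
  ... | p′ , p≋cp′ = ∣ᶜ-resp (≋-sym qp≋cqp′) (∣ᶜ-scale c (p′ *P q))
    where
    open ≋-Reasoning
    qp≋cqp′ : q *P p ≋ scale c (p′ *P q)
    qp≋cqp′ = begin
      q *P p           ≈⟨ *P-congʳ q p≋cp′ ⟩
      q *P scale c p′  ≈⟨ *P-comm q (scale c p′) ⟩
      scale c p′ *P q  ≈⟨ scale-*P c p′ q ⟩
      scale c (p′ *P q) ∎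

  prime-euclid : ∀ {p} a b → Prime p → + p ∣ℤ a * b → + p ∣ℤ a ⊎ + p ∣ℤ b
  prime-euclid {p} a b p-prime p∣ab =
    Sum.map ∣ᵤ⇒∣ ∣ᵤ⇒∣ (euclidsLemma ∣ a ∣ ∣ b ∣ p-prime (subst (p ℕ.∣_) (ℤ.abs-* a b) (∣⇒∣ᵤ p∣ab)))

  coeff-∷-*P-suc : ∀ a q r i → coeff ((a ∷ q) *P r) (suc i) ≡ a * coeff r (suc i) + coeff (q *P r) i
  coeff-∷-*P-suc a q r i =
    trans (coeff-+P (scale a r) (+ 0 ∷ q *P r) (suc i)) (cong (_+ coeff (q *P r) i) (coeff-scale a r (suc i)))

  ∣ᶜ-tail : ∀ {c a} q r → c ∣ℤ a → c ∣ᶜ (a ∷ q) *P r → c ∣ᶜ q *P r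
  ∣ᶜ-tail {c} {a} q r c∣a c∣aqr i =
    ∣m+n∣m⇒∣n (subst (c ∣ℤ_) (coeff-∷-*P-suc a q r i) (c∣aqr (suc i))) (∣m⇒∣m*n (coeff r (suc i)) c∣a)

  gauss : ∀ {p} → Prime p → ∀ q r → + p ∣ᶜ q *P r → + p ∣ᶜ q ⊎ + p ∣ᶜ r
  gauss p-prime []      r _ = inj₁ (∣ᶜ-[] _)
  gauss {p} p-prime (a ∷ q) r p∣aqr with + p ∣? a
  ... | yes p∣a = Sum.map₁ (∣ᶜ-∷ p∣a) (gauss p-prime q r (∣ᶜ-tail q r p∣a p∣aqr))
  ... | no  p∤a = inj₂ (gauss-head r (∣ᶜ-resp (*P-comm (a ∷ q) r) p∣aqr))
    where
    gauss-head : ∀ r → + p ∣ᶜ r *P (a ∷ q) → + p ∣ᶜ r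
    gauss-head []      _ = ∣ᶜ-[] _
    gauss-head (b ∷ r) p∣bra with prime-euclid b a p-prime (subst (+ p ∣ℤ_) (ℤ.+-identityʳ (b * a)) (p∣bra zero))
    ... | inj₁ p∣b = ∣ᶜ-∷ p∣b (gauss-head r (∣ᶜ-tail r (a ∷ q) p∣b p∣bra))
    ... | inj₂ p∣a = ⊥-elim (p∤a p∣a)

  Primitive : Poly → Set
  Primitive e = ∀ p → Prime p → ¬ + p ∣ᶜ e

  primitive-∣ : ∀ {e f} → Primitive f → e ∣ f → Primitive e
  primitive-∣ f-primitive (r , r*e≋f) p p-prime p∣e = f-primitive p p-prime (∣ᶜ-resp r*e≋f (∣ᶜ-*P-left r p∣e))

  prime>1 : ∀ {p} → Prime p → 1 ℕ.< p
  prime>1 {p} p-prime = ℕ.nonTrivial⇒n>1 p {{prime⇒nonTrivial p-prime}}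

  prime-divisor : ∀ m → Σ ℕ λ p → Prime p × p ℕ.∣ suc (suc m)
  prime-divisor m with factorise (suc (suc m))
  ... | record { factors = []     ; isFactorisation = () }
  ... | record { factors = p ∷ ps ; isFactorisation = n≡p*ps ; factorsPrime = p-prime ∷ _ } =
    p , p-prime , subst (p ℕ.∣_) (sym n≡p*ps) (ℕ.m∣m*n _)

  nonzero-induction : ∀ {ℓ} (P : ℤ → Set ℓ) →
    (∀ {u} → u * u ≡ + 1 → P u) →
    (∀ {c p} → Prime p → P c → P (c * + p)) →
    ∀ c → c ≢ + 0 → P c
  nonzero-induction P unit step c c≢0 = go c (<-wellFounded ∣ c ∣) c≢0
    where
    descend : ∀ c m → ∣ c ∣ ≡ suc (suc m) → (∀ {c′} → ∣ c′ ∣ ℕ.< ∣ c ∣ → c′ ≢ + 0 → P c′) → P c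
    descend c m ∣c∣≡ ih with prime-divisor m
    ... | p , p-prime , p∣∣c∣ with ∣ᵤ⇒∣ {+ p} {c} (subst (p ℕ.∣_) (sym ∣c∣≡) p∣∣c∣)
    ... | divides c′ c≡c′p = subst P (sym c≡c′p) (step p-prime (ih ∣c′∣<∣c∣ c′≢0))
      where
      ∣c∣≡∣c′∣p : ∣ c ∣ ≡ ∣ c′ ∣ ℕ.* p
      ∣c∣≡∣c′∣p = trans (cong ∣_∣ c≡c′p) (ℤ.abs-* c′ (+ p))
      c′≢0 : c′ ≢ + 0
      c′≢0 refl = ℕ.0≢1+n (trans (sym ∣c∣≡∣c′∣p) ∣c∣≡)
      ∣c′∣<∣c∣ : ∣ c′ ∣ ℕ.< ∣ c ∣
      ∣c′∣<∣c∣ = subst (∣ c′ ∣ ℕ.<_) (sym ∣c∣≡∣c′∣p)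
        (ℕ.m<m*n ∣ c′ ∣ p {{ℕ.≢-nonZero (λ ∣c′∣≡0 → c′≢0 (ℤ.∣i∣≡0⇒i≡0 ∣c′∣≡0))}} (prime>1 p-prime))
    go : ∀ c → Acc ℕ._<_ ∣ c ∣ → c ≢ + 0 → P c
    go (+ 0)               _        c≢0 = ⊥-elim (c≢0 refl)
    go (+ 1)               _        _   = unit refl
    go -[1+ 0 ]            _        _   = unit refl
    go c@(+ suc (suc m))   (acc rs) _   = descend c m refl λ lt → go _ (rs lt)
    go c@(-[1+ suc m ])    (acc rs) _   = descend c m refl λ lt → go _ (rs lt)

  scale-*-swap : ∀ c d p → scale (c * d) p ≋ scale d (scale c p)
  scale-*-swap c d p = ≋-trans (scale-congˡ p (ℤ.*-comm c d)) (≋-sym (scale-scale d c p))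

  +p≢0 : ∀ {p} → Prime p → + p ≢ + 0
  +p≢0 p-prime +p≡0 = ℕ.<⇒≢ (ℕ.<-trans (ℕ.s≤s ℕ.z≤n) (prime>1 p-prime)) (sym (ℤ.+-injective +p≡0))

  primitive-cancel : ∀ {e} → Primitive e → ∀ c → c ≢ + 0 → ∀ {A r} → scale c A ≋ r *P e → e ∣ A
  primitive-cancel {e} e-primitive = nonzero-induction (λ c → ∀ {A r} → scale c A ≋ r *P e → e ∣ A)
    (λ {u} → unit {u}) (λ {c} {p} → step {c} {p})
    where
    unit : ∀ {u} → u * u ≡ + 1 → ∀ {A r} → scale u A ≋ r *P e → e ∣ A
    unit {u} uu≡1 {A} {r} uA≋re = scale u r , ≋-sym (begin
      A                   ≈⟨ scale-identity A ⟨
      scale (+ 1) A       ≈⟨ scale-congˡ A (sym uu≡1) ⟩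
      scale (u * u) A     ≈⟨ scale-scale u u A ⟨
      scale u (scale u A) ≈⟨ scale-cong u uA≋re ⟩
      scale u (r *P e)    ≈⟨ scale-*P u r e ⟨
      scale u r *P e      ∎)
      where open ≋-Reasoning
    step : ∀ {c p} → Prime p → (∀ {A r} → scale c A ≋ r *P e → e ∣ A) →
           ∀ {A r} → scale (c * + p) A ≋ r *P e → e ∣ A
    step {c} {p} p-prime ih {A} {r} cpA≋re
      with gauss p-prime r e (∣ᶜ-resp (≋-trans (≋-sym (scale-*-swap c (+ p) A)) cpA≋re) (∣ᶜ-scale (+ p) (scale c A)))
    ... | inj₂ p∣e = ⊥-elim (e-primitive p p-prime p∣e)
    ... | inj₁ p∣r with ∣ᶜ⇒scale (+ p) r p∣r
    ... | r′ , r≋pr′ = ih {r = r′} (scale-cancel (+ p) (+p≢0 p-prime) (begin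
      scale (+ p) (scale c A) ≈⟨ scale-*-swap c (+ p) A ⟨
      scale (c * + p) A       ≈⟨ cpA≋re ⟩
      r *P e                  ≈⟨ *P-congˡ e r≋pr′ ⟩
      scale (+ p) r′ *P e     ≈⟨ scale-*P (+ p) r′ e ⟩
      scale (+ p) (r′ *P e)   ∎))
      where open ≋-Reasoning

  infix 4 _⊥ᶜ_
  _⊥ᶜ_ : ℤ → Poly → Set
  c ⊥ᶜ B = ∀ p → Prime p → + p ∣ℤ c → ¬ + p ∣ᶜ B

  coprime-content-cancel : ∀ {B} c → c ≢ + 0 → c ⊥ᶜ B → ∀ {r W} → scale c r ≋ B *P W → c ∣ᶜ W
  coprime-content-cancel {B} = nonzero-induction (λ c → c ⊥ᶜ B → ∀ {r W} → scale c r ≋ B *P W → c ∣ᶜ W)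
    (λ {u} → unit {u}) (λ {c} {p} → step {c} {p})
    where
    unit : ∀ {u} → u * u ≡ + 1 → u ⊥ᶜ B → ∀ {r W} → scale u r ≋ B *P W → u ∣ᶜ W
    unit {u} uu≡1 _ {W = W} _ i = divides (u * coeff W i) (begin
      coeff W i               ≡⟨ ℤ.*-identityˡ (coeff W i) ⟨
      + 1 * coeff W i         ≡⟨ cong (_* coeff W i) (sym uu≡1) ⟩
      u * u * coeff W i       ≡⟨ rearrange u (coeff W i) ⟩
      u * coeff W i * u       ∎)
      where
      open ≡-Reasoning
      rearrange : ∀ u w → u * u * w ≡ u * w * u
      rearrange = ℤ-Solver.solve-∀
    step : ∀ {c p} → Prime p → (c ⊥ᶜ B → ∀ {r W} → scale c r ≋ B *P W → c ∣ᶜ W) →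
           c * + p ⊥ᶜ B → ∀ {r W} → scale (c * + p) r ≋ B *P W → c * + p ∣ᶜ W
    step {c} {p} p-prime ih cp⊥B {r} {W} cpr≋BW
      with gauss p-prime B W (∣ᶜ-resp (≋-trans (≋-sym (scale-*-swap c (+ p) r)) cpr≋BW) (∣ᶜ-scale (+ p) (scale c r)))
    ... | inj₁ p∣B = ⊥-elim (cp⊥B p p-prime (∣n⇒∣m*n c (divides (+ 1) (sym (ℤ.*-identityˡ (+ p))))) p∣B)
    ... | inj₂ p∣W with ∣ᶜ⇒scale (+ p) W p∣W
    ... | W′ , W≋pW′ = λ i →
      subst₂ _∣ℤ_ (ℤ.*-comm (+ p) c) (sym (trans (coeff-≡ W≋pW′ i) (coeff-scale (+ p) W′ i))) (*-monoʳ-∣ (+ p) (c∣W′ i))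
      where
      open ≋-Reasoning
      c⊥B : c ⊥ᶜ B
      c⊥B q q-prime q∣c = cp⊥B q q-prime (∣m⇒∣m*n (+ p) q∣c)
      c∣W′ : c ∣ᶜ W′
      c∣W′ = ih c⊥B {r} {W′} (scale-cancel (+ p) (+p≢0 p-prime) (begin
        scale (+ p) (scale c r) ≈⟨ scale-*-swap c (+ p) r ⟨
        scale (c * + p) r       ≈⟨ cpr≋BW ⟩
        B *P W                  ≈⟨ *P-congʳ B W≋pW′ ⟩
        B *P scale (+ p) W′     ≈⟨ *P-comm B (scale (+ p) W′) ⟩
        scale (+ p) W′ *P B     ≈⟨ scale-*P (+ p) W′ B ⟩
        scale (+ p) (W′ *P B)   ≈⟨ scale-cong (+ p) (*P-comm W′ B) ⟩
        scale (+ p) (B *P W′)   ∎))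

  content : Poly → ℕ
  content []      = 0
  content (a ∷ p) = gcd ∣ a ∣ (content p)

  content-∣ : ∀ p i → content p ℕ.∣ ∣ coeff p i ∣
  content-∣ []      i       = ℕ.divides 0 refl
  content-∣ (a ∷ p) zero    = gcd[m,n]∣m ∣ a ∣ (content p)
  content-∣ (a ∷ p) (suc i) = ℕ.∣-trans (gcd[m,n]∣n ∣ a ∣ (content p)) (content-∣ p i)

  content-greatest : ∀ {d} p → (∀ i → d ℕ.∣ ∣ coeff p i ∣) → d ℕ.∣ content p
  content-greatest []      _   = ℕ.divides 0 refl
  content-greatest (a ∷ p) d∣p = gcd-greatest (d∣p zero) (content-greatest p (λ i → d∣p (suc i)))

  primitive-part : ∀ p → ¬ p ≋ [] → Σ ℤ λ c → Σ Poly λ p′ → c ≢ + 0 × p ≋ scale c p′ × Primitive p′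
  primitive-part p p≢0 with ∣ᶜ⇒scale (+ content p) p (λ i → ∣ᵤ⇒∣ (content-∣ p i))
  ... | p′ , p≋cp′ = + content p , p′ , c≢0 , p≋cp′ , p′-primitive
    where
    c≢0 : + content p ≢ + 0
    c≢0 c≡0 = p≢0 (mk≋ λ i →
      ℤ.∣i∣≡0⇒i≡0 (ℕ.0∣⇒≡0 (subst (ℕ._∣ ∣ coeff p i ∣) (ℤ.+-injective c≡0) (content-∣ p i))))
    p′-primitive : Primitive p′
    p′-primitive q q-prime q∣p′ with ∣ᶜ⇒scale (+ q) p′ q∣p′
    ... | p″ , p′≋qp″ = ¬prime[1] (subst Prime q≡1 q-prime)
      where
      cq∣p : + content p * + q ∣ᶜ p
      cq∣p = ∣ᶜ-resp (≋-sym (≋-trans p≋cp′ (≋-trans (scale-cong (+ content p) p′≋qp″) (scale-scale (+ content p) (+ q) p″))))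
                    (∣ᶜ-scale (+ content p * + q) p″)
      q≡1 : q ≡ 1
      q≡1 = ℕ.∣1⇒≡1 (ℕ.*-cancelˡ-∣ (content p) {{ℕ.≢-nonZero (λ c≡0 → c≢0 (cong +_ c≡0))}}
              (subst (content p ℕ.* q ℕ.∣_) (sym (ℕ.*-identityʳ (content p)))
                (content-greatest p (λ i → subst (ℕ._∣ ∣ coeff p i ∣) (ℤ.abs-* (+ content p) (+ q)) (∣⇒∣ᵤ (cq∣p i))))))

  Degree : Poly → ℕ → Set
  Degree p t = coeff p t ≢ + 0 × (∀ i → t ℕ.< i → coeff p i ≡ + 0)

  DegreeBelow : ℕ → Poly → Set
  DegreeBelow t p = ∀ i → t ℕ.≤ i → coeff p i ≡ + 0

  zero-or-degree : ∀ p → p ≋ [] ⊎ Σ ℕ (Degree p)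
  zero-or-degree [] = inj₁ ≋-refl
  zero-or-degree (a ∷ p) with zero-or-degree p
  ... | inj₂ (t , lead≢0 , high≡0) = inj₂ (suc t , lead≢0 , λ { zero () ; (suc i) (s≤s t<i) → high≡0 i t<i })
  ... | inj₁ p≋0 with a ℤ.≟ + 0
  ...   | yes refl = inj₁ (0∷≋[] p≋0)
  ...   | no  a≢0  = inj₂ (zero , a≢0 , λ { zero () ; (suc i) _ → coeff-≡ p≋0 i })

  degree-< : ∀ {p s t} → Degree p s → DegreeBelow t p → s ℕ.< t
  degree-< (lead≢0 , _) below = ℕ.≰⇒> (λ t≤s → lead≢0 (below _ t≤s))

  degree-scale⁻¹ : ∀ {p p′ c t} → c ≢ + 0 → p ≋ scale c p′ → Degree p t → Degree p′ t
  degree-scale⁻¹ {p} {p′} {c} {t} c≢0 p≋cp′ (lead≢0 , high≡0) =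
    (λ p′ₜ≡0 → lead≢0 (trans (coeff-p t) (trans (cong (c *_) p′ₜ≡0) (ℤ.*-zeroʳ c)))) ,
    (λ i t<i → [ (λ c≡0 → ⊥-elim (c≢0 c≡0)) , (λ p′ᵢ≡0 → p′ᵢ≡0) ]′
                 (ℤ.i*j≡0⇒i≡0∨j≡0 c (trans (sym (coeff-p i)) (high≡0 i t<i))))
    where
    coeff-p : ∀ i → coeff p i ≡ c * coeff p′ i
    coeff-p i = trans (coeff-≡ p≋cp′ i) (coeff-scale c p′ i)

  const-*P-const : ∀ a b → const (a * b) ≋ const a *P const b
  const-*P-const a b = mk≋ λ { zero → sym (ℤ.+-identityʳ (a * b)) ; (suc i) → refl }

  coeff-const-*P : ∀ c p i → coeff (const c *P p) i ≡ c * coeff p i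
  coeff-const-*P c p i = trans (coeff-≡ (const-*P c p) i) (coeff-scale c p i)

  module PseudoDivision {B : Poly} {t : ℕ} (B-degree : Degree B t) where

    b : ℤ
    b = coeff B t

    cancel-leading : ∀ X → DegreeBelow (suc t) X → DegreeBelow t (const b *P X +P -P (const (coeff X t) *P B))
    cancel-leading X X-below i t≤i = begin
      coeff (const b *P X +P -P (const Xₜ *P B)) i               ≡⟨ coeff-+P (const b *P X) (-P (const Xₜ *P B)) i ⟩
      coeff (const b *P X) i + coeff (-P (const Xₜ *P B)) i      ≡⟨ cong₂ _+_ (coeff-const-*P b X i)
                                                                      (trans (coeff-scale (- + 1) (const Xₜ *P B) i) (cong (- + 1 *_) (coeff-const-*P Xₜ B i))) ⟩
      b * coeff X i + - + 1 * (Xₜ * coeff B i)                   ≡⟨ vanish (ℕ.m≤n⇒m<n∨m≡n t≤i) ⟩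
      + 0                                                        ∎
      where
      open ≡-Reasoning
      Xₜ = coeff X t
      vanish : t ℕ.< i ⊎ t ≡ i → b * coeff X i + - + 1 * (Xₜ * coeff B i) ≡ + 0
      vanish (inj₁ t<i) rewrite X-below i t<i | proj₂ B-degree i t<i | ℤ.*-zeroʳ b | ℤ.*-zeroʳ Xₜ = refl
      vanish (inj₂ refl) = cancel b Xₜ
        where
        cancel : ∀ b x → b * x + - + 1 * (x * b) ≡ + 0
        cancel b x = trans (cong (_+_ (b * x)) (trans (ℤ.-1*i≡-i (x * b)) (cong -_ (ℤ.*-comm x b)))) (ℤ.+-inverseʳ (b * x))

    pseudo-divide : ∀ A → Σ ℕ λ k → Σ Poly λ Q → Σ Poly λ R → scale (b ^ k) A ≋ Q *P B +P R × DegreeBelow t R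
    pseudo-divide [] = 0 , [] , [] , ≋-refl , λ _ _ → refl
    pseudo-divide (a ∷ A) with pseudo-divide A
    ... | k , Q , R , bᵏA≋QB+R , R-below =
      suc k , const b *P (+ 0 ∷ Q) +P const Xₜ , const b *P X +P -P (const Xₜ *P B) , division , cancel-leading X X-below
      where
      X : Poly
      X = b ^ k * a ∷ R
      Xₜ = coeff X t
      X-below : DegreeBelow (suc t) X
      X-below (suc i) (s≤s t≤i) = R-below i t≤i
      open ≋-Reasoning
      shifted : scale (b ^ k) (a ∷ A) ≋ (+ 0 ∷ Q) *P B +P X
      shifted = begin
        b ^ k * a ∷ scale (b ^ k) A    ≈⟨ ∷-cong (sym (ℤ.+-identityˡ (b ^ k * a))) bᵏA≋QB+R ⟩
        + 0 + b ^ k * a ∷ Q *P B +P R  ≈⟨ +P-cong (shift-*P Q B) ≋-refl ⟨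
        (+ 0 ∷ Q) *P B +P X            ∎
      distribute : ∀ c q B X d → c *P (q *P B +P X) ≋ (c *P q +P d) *P B +P (c *P X +P -P (d *P B))
      distribute = solve-∀ ℤ[x]-almost
      division : scale (b ^ suc k) (a ∷ A) ≋ (const b *P (+ 0 ∷ Q) +P const Xₜ) *P B +P (const b *P X +P -P (const Xₜ *P B))
      division = begin
        scale (b * b ^ k) (a ∷ A)           ≈⟨ scale-scale b (b ^ k) (a ∷ A) ⟨
        scale b (scale (b ^ k) (a ∷ A))     ≈⟨ const-*P b _ ⟨
        const b *P scale (b ^ k) (a ∷ A)    ≈⟨ *P-congʳ (const b) shifted ⟩
        const b *P ((+ 0 ∷ Q) *P B +P X)    ≈⟨ distribute (const b) (+ 0 ∷ Q) B X (const Xₜ) ⟩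
        (const b *P (+ 0 ∷ Q) +P const Xₜ) *P B +P (const b *P X +P -P (const Xₜ *P B)) ∎

  Coprime : Poly → Poly → Set
  Coprime A B = ∀ e → e ∣ A → e ∣ B → e ∣ 1P

  -- Over ℤ a Bézout identity for coprime polynomials only reaches a nonzero constant.
  Bezout : Poly → Poly → Set
  Bezout A B = Σ Poly λ U → Σ Poly λ V → Σ ℤ λ c → c ≢ + 0 × U *P A +P V *P B ≋ const c

  coprime⇒bezout : ∀ {A B t} → Degree B t → Coprime A B → Bezout A B
  coprime⇒bezout {t = t} = <-rec (λ t → ∀ {A B} → Degree B t → Coprime A B → Bezout A B) step t
    where
    step : ∀ t → (∀ {s} → s ℕ.< t → ∀ {A B} → Degree B s → Coprime A B → Bezout A B) →
           ∀ {A B} → Degree B t → Coprime A B → Bezout A B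
    step t ih {A} {B} B-degree A⊥B with primitive-part B (λ B≋0 → proj₁ B-degree (coeff-≡ B≋0 t))
    ... | cB , B′ , cB≢0 , B≋cB′ , B′-primitive with PseudoDivision.pseudo-divide B′-degree A
      where B′-degree = degree-scale⁻¹ cB≢0 B≋cB′ B-degree
    ... | k , Q , R , βA≋QB′+R , R-below = from-remainder (zero-or-degree R)
      where
      open ≋-Reasoning
      β = coeff B′ t ^ k
      β≢0 : β ≢ + 0
      β≢0 β≡0 = proj₁ (degree-scale⁻¹ cB≢0 B≋cB′ B-degree) (ℤ.i^n≡0⇒i≡0 (coeff B′ t) k β≡0)
      B≋cB*B′ : B ≋ const cB *P B′
      B≋cB*B′ = ≋-trans B≋cB′ (≋-sym (const-*P cB B′))
      B′∣B : B′ ∣ B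
      B′∣B = const cB , ≋-sym B≋cB*B′
      from-remainder : R ≋ [] ⊎ Σ ℕ (Degree R) → Bezout A B
      from-remainder (inj₁ R≋0) with A⊥B B′ B′∣A B′∣B
        where
        B′∣A : B′ ∣ A
        B′∣A = primitive-cancel B′-primitive β β≢0 {r = Q} (≋-trans βA≋QB′+R (≋-trans (+P-cong ≋-refl R≋0) (+P-identityʳ _)))
      ... | r , rB′≋1 = [] , r , cB , cB≢0 , (begin
        r *P B                 ≈⟨ *P-congʳ r B≋cB*B′ ⟩
        r *P (const cB *P B′)  ≈⟨ swap r (const cB) B′ ⟩
        const cB *P (r *P B′)  ≈⟨ *P-congʳ (const cB) rB′≋1 ⟩
        const cB *P 1P         ≈⟨ const-*P-const cB (+ 1) ⟨
        const (cB * + 1)       ≈⟨ mk≋ (λ { zero → ℤ.*-identityʳ cB ; (suc i) → refl }) ⟩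
        const cB               ∎)
        where
        swap : ∀ x y z → x *P (y *P z) ≋ y *P (x *P z)
        swap = solve-∀ ℤ[x]-almost
      from-remainder (inj₂ (s , R-degree)) with ih (degree-< {R} R-degree R-below) R-degree B′⊥R
        where
        B′⊥R : Coprime B′ R
        B′⊥R e e∣B′ e∣R = A⊥B e e∣A (∣-trans e∣B′ B′∣B)
          where
          e∣βA : e ∣ scale β A
          e∣βA = ∣-respʳ (≋-sym βA≋QB′+R) (∣-+P (∣-*P-left Q e∣B′) e∣R)
          e∣A : e ∣ A
          e∣A = primitive-cancel (primitive-∣ B′-primitive e∣B′) β β≢0 {r = proj₁ e∣βA} (≋-sym (proj₂ e∣βA))
      ... | U , V , c , c≢0 , UB′+VR≋c = const cB *P (const β *P V) , U +P -P (V *P Q) , cB * c , cBc≢0 , (begin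
        (const cB *P (const β *P V)) *P A +P (U +P -P (V *P Q)) *P B
          ≈⟨ +P-cong ≋-refl (*P-congʳ (U +P -P (V *P Q)) B≋cB*B′) ⟩
        (const cB *P (const β *P V)) *P A +P (U +P -P (V *P Q)) *P (const cB *P B′)
          ≈⟨ expand (const cB) (const β) V A U Q B′ ⟩
        const cB *P (U *P B′ +P V *P (const β *P A +P -P (Q *P B′)))
          ≈⟨ *P-congʳ (const cB) (+P-cong ≋-refl (*P-congʳ V R≋βA-QB′)) ⟨
        const cB *P (U *P B′ +P V *P R)
          ≈⟨ *P-congʳ (const cB) UB′+VR≋c ⟩
        const cB *P const c
          ≈⟨ const-*P-const cB c ⟨
        const (cB * c) ∎)
        where
        cBc≢0 : cB * c ≢ + 0
        cBc≢0 cBc≡0 = [ cB≢0 , c≢0 ]′ (ℤ.i*j≡0⇒i≡0∨j≡0 cB cBc≡0)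
        expand : ∀ cB β V A U Q B′ →
          (cB *P (β *P V)) *P A +P (U +P -P (V *P Q)) *P (cB *P B′) ≋ cB *P (U *P B′ +P V *P (β *P A +P -P (Q *P B′)))
        expand = solve-∀ ℤ[x]-almost
        R≋βA-QB′ : R ≋ const β *P A +P -P (Q *P B′)
        R≋βA-QB′ = begin
          R                                    ≈⟨ isolate R (Q *P B′) ⟩
          (Q *P B′ +P R) +P -P (Q *P B′)       ≈⟨ +P-cong (≋-trans (≋-sym βA≋QB′+R) (≋-sym (const-*P β A))) ≋-refl ⟩
          const β *P A +P -P (Q *P B′)         ∎
          where
          isolate : ∀ R X → R ≋ (X +P R) +P -P X
          isolate = solve-∀ ℤ[x]-almost

  ∣ᶜ⇒const-∣ : ∀ {c p} → c ∣ᶜ p → const c ∣ p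
  ∣ᶜ⇒const-∣ {c} {p} c∣p with ∣ᶜ⇒scale c p c∣p
  ... | p′ , p≋cp′ = p′ , ≋-trans (*P-comm p′ (const c)) (≋-trans (const-*P c p′) (≋-sym p≋cp′))

  const-prime-∤-1P : ∀ {p} → Prime p → ¬ const (+ p) ∣ 1P
  const-prime-∤-1P {p} p-prime (r , r*p≋1) = ¬prime[1] (subst Prime p≡1 p-prime)
    where
    p*r₀≡1 : + p * coeff r 0 ≡ + 1
    p*r₀≡1 = trans (sym (coeff-const-*P (+ p) r 0)) (trans (coeff-≡ (*P-comm (const (+ p)) r) 0) (coeff-≡ r*p≋1 0))
    p≡1 : p ≡ 1
    p≡1 = ℕ.∣1⇒≡1 (∣⇒∣ᵤ {+ p} {+ 1} (divides (coeff r 0) (sym (trans (ℤ.*-comm (coeff r 0) (+ p)) p*r₀≡1))))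

  ∣-scale-cancel : ∀ {A B Z} c → c ≢ + 0 → Coprime A B → A ∣ B *P Z → A ∣ scale c Z → A ∣ Z
  ∣-scale-cancel {A} {B} {Z} c c≢0 A⊥B (s , sA≋BZ) (r , rA≋cZ) with zero-or-degree A
  ... | inj₁ A≋0 = [] , ≋-sym (scale-cancel c c≢0 (begin
    scale c Z    ≈⟨ rA≋cZ ⟨
    r *P A       ≈⟨ *P-congʳ r A≋0 ⟩
    r *P []      ≈⟨ *P-zeroʳ r ⟩
    []           ∎))
    where open ≋-Reasoning
  ... | inj₂ (t , A-degree) with primitive-part A (λ A≋0 → proj₁ A-degree (coeff-≡ A≋0 t))
  ... | a , A′ , a≢0 , A≋aA′ , A′-primitive = W′ , (begin
    W′ *P A                ≈⟨ *P-congʳ W′ A≋a*A′ ⟩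
    W′ *P (const a *P A′)  ≈⟨ rotate W′ (const a) A′ ⟩
    (const a *P W′) *P A′  ≈⟨ *P-congˡ A′ (≋-trans (const-*P a W′) (≋-sym W≋aW′)) ⟩
    W *P A′                ≈⟨ WA′≋Z ⟩
    Z                      ∎)
    where
    open ≋-Reasoning
    rotate : ∀ x y z → x *P (y *P z) ≋ (y *P x) *P z
    rotate = solve-∀ ℤ[x]-almost
    A≋a*A′ : A ≋ const a *P A′
    A≋a*A′ = ≋-trans A≋aA′ (≋-sym (const-*P a A′))
    A′≢0 : ¬ A′ ≋ []
    A′≢0 A′≋0 = proj₁ A-degree (coeff-≡ (≋-trans A≋a*A′ (≋-trans (*P-congʳ (const a) A′≋0) (*P-zeroʳ (const a)))) t)
    A′∣Z : A′ ∣ Z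
    A′∣Z = primitive-cancel A′-primitive c c≢0 {r = r *P const a}
      (≋-trans (≋-sym rA≋cZ) (≋-trans (*P-congʳ r A≋a*A′) (≋-sym (*P-assoc r (const a) A′))))
    W = proj₁ A′∣Z
    WA′≋Z = proj₂ A′∣Z
    as≋BW : scale a s ≋ B *P W
    as≋BW = *P-cancelʳ A′ A′≢0 (begin
      scale a s *P A′         ≈⟨ *P-congˡ A′ (const-*P a s) ⟨
      (const a *P s) *P A′    ≈⟨ rotate s (const a) A′ ⟨
      s *P (const a *P A′)    ≈⟨ *P-congʳ s A≋a*A′ ⟨
      s *P A                  ≈⟨ sA≋BZ ⟩
      B *P Z                  ≈⟨ *P-congʳ B WA′≋Z ⟨
      B *P (W *P A′)          ≈⟨ *P-assoc B W A′ ⟨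
      (B *P W) *P A′          ∎)
    -- a prime dividing a and the content of B would be a common constant factor of A and B
    a⊥B : a ⊥ᶜ B
    a⊥B p p-prime p∣a p∣B = const-prime-∤-1P p-prime (A⊥B (const (+ p)) (∣ᶜ⇒const-∣ p∣A) (∣ᶜ⇒const-∣ p∣B))
      where
      p∣A : + p ∣ᶜ A
      p∣A = ∣ᶜ-resp (≋-sym A≋aA′) (λ i → subst (+ p ∣ℤ_) (sym (coeff-scale a A′ i)) (∣m⇒∣m*n (coeff A′ i) p∣a))
    W-scaled = ∣ᶜ⇒scale a W (coprime-content-cancel {B} a a≢0 a⊥B as≋BW)
    W′ = proj₁ W-scaled
    W≋aW′ = proj₂ W-scaled

  coprime-euclid : ∀ {A B Z} → Coprime A B → A ∣ B *P Z → A ∣ Z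
  coprime-euclid {A} {B} {Z} A⊥B A∣BZ with zero-or-degree B
  ... | inj₁ B≋0 = ∣1P⇒∣ Z (A⊥B A (∣-refl A) ([] , ≋-sym B≋0))
  ... | inj₂ (_ , B-degree) with coprime⇒bezout B-degree A⊥B
  ... | U , V , c , c≢0 , UA+VB≋c = ∣-scale-cancel c c≢0 A⊥B A∣BZ (∣-respʳ UZA+VBZ≋cZ (∣-+P (∣-factor A (U *P Z)) (∣-*P-left V A∣BZ)))
    where
    open ≋-Reasoning
    regroup : ∀ U A V B Z → (U *P Z) *P A +P V *P (B *P Z) ≋ (U *P A +P V *P B) *P Z
    regroup = solve-∀ ℤ[x]-almost
    UZA+VBZ≋cZ : (U *P Z) *P A +P V *P (B *P Z) ≋ scale c Z
    UZA+VBZ≋cZ = begin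
      (U *P Z) *P A +P V *P (B *P Z)  ≈⟨ regroup U A V B Z ⟩
      (U *P A +P V *P B) *P Z         ≈⟨ *P-congˡ Z UA+VB≋c ⟩
      const c *P Z                    ≈⟨ const-*P c Z ⟩
      scale c Z                       ∎

  infixr 8 _^P_
  _^P_ : Poly → ℕ → Poly
  p ^P zero  = 1P
  p ^P suc n = p *P p ^P n

  coprime-∣-^P-cancel : ∀ {A B Y} n → Coprime A B → A ∣ B ^P n *P Y → A ∣ Y
  coprime-∣-^P-cancel {Y = Y} zero      _   A∣Y = ∣-respʳ (*P-identityˡ Y) A∣Y
  coprime-∣-^P-cancel {B = B} {Y} (suc n) A⊥B A∣BⁿY =
    coprime-∣-^P-cancel n A⊥B (coprime-euclid A⊥B (∣-respʳ (*P-assoc B (B ^P n) Y) A∣BⁿY))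

  coprime-∣ˡ : ∀ {A A′ B} → A′ ∣ A → Coprime A B → Coprime A′ B
  coprime-∣ˡ A′∣A A⊥B e e∣A′ e∣B = A⊥B e (∣-trans e∣A′ A′∣A) e∣B

  coprime-sym : ∀ {A B} → Coprime A B → Coprime B A
  coprime-sym A⊥B e e∣B e∣A = A⊥B e e∣A e∣B

  -P-involutive : ∀ p → -P (-P p) ≋ p
  -P-involutive = solve-∀ ℤ[x]-almost

  coprime-negʳ : ∀ {A B} → Coprime A B → Coprime A (-P B)
  coprime-negʳ {B = B} A⊥B e e∣A e∣-B = A⊥B e e∣A (∣-respʳ (-P-involutive B) (∣-scale (- + 1) e∣-B))

  IsGCD[1]⇒coprime : ∀ {A B} → IsGCD 1P A B → Coprime A B
  IsGCD[1]⇒coprime (_ , _ , greatest) e e∣A e∣B = ∣P⇒∣ (greatest e (∣⇒∣P e∣A) (∣⇒∣P e∣B))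

  ∣p0∣∈[1,2]⇒p0∣2 : ∀ p0 → ∣ p0 ∣ ≡ 1 ⊎ ∣ p0 ∣ ≡ 2 → p0 ∣ℤ + 2
  ∣p0∣∈[1,2]⇒p0∣2 (+ 1)                 _        = divides (+ 2) refl
  ∣p0∣∈[1,2]⇒p0∣2 (+ 2)                 _        = divides (+ 1) refl
  ∣p0∣∈[1,2]⇒p0∣2 (-[1+ 0 ])            _        = divides (- + 2) refl
  ∣p0∣∈[1,2]⇒p0∣2 (-[1+ 1 ])            _        = divides (- + 1) refl
  ∣p0∣∈[1,2]⇒p0∣2 (+ 0)                 (inj₁ ())
  ∣p0∣∈[1,2]⇒p0∣2 (+ 0)                 (inj₂ ())
  ∣p0∣∈[1,2]⇒p0∣2 (+ suc (suc (suc _))) (inj₁ ())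
  ∣p0∣∈[1,2]⇒p0∣2 (+ suc (suc (suc _))) (inj₂ ())
  ∣p0∣∈[1,2]⇒p0∣2 (-[1+ suc (suc _) ])  (inj₁ ())
  ∣p0∣∈[1,2]⇒p0∣2 (-[1+ suc (suc _) ])  (inj₂ ())

  half-multiplier : ∀ {p0 p1 d} → p0 ∣ℤ + 2 → scale (+ 2) p1 ≋ scale p0 d →
                    Σ Poly λ α → α *P const p0 ≋ const (+ 2) × α *P p1 ≋ d
  half-multiplier {p0} {p1} {d} (divides α 2≡αp0) 2p1≋p0d =
    const α , ≋-trans (≋-sym (const-*P-const α p0)) (≋-reflexive (cong const (sym 2≡αp0))) ,
    scale-cancel (+ 2) (λ ()) (begin
      scale (+ 2) (const α *P p1) ≈⟨ scale-cong (+ 2) (const-*P α p1) ⟩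
      scale (+ 2) (scale α p1)    ≈⟨ scale-scale (+ 2) α p1 ⟩
      scale (+ 2 * α) p1          ≈⟨ scale-congˡ p1 (ℤ.*-comm (+ 2) α) ⟩
      scale (α * + 2) p1          ≈⟨ scale-scale α (+ 2) p1 ⟨
      scale α (scale (+ 2) p1)    ≈⟨ scale-cong α 2p1≋p0d ⟩
      scale α (scale p0 d)        ≈⟨ scale-scale α p0 d ⟩
      scale (α * p0) d            ≈⟨ scale-congˡ d 2≡αp0 ⟨
      scale (+ 2) d               ∎)
    where open ≋-Reasoning

module Indices where

  open import Data.Nat using (ℕ; suc; _+_; _*_; _^_; _∸_; _≤_; _<_; s≤s)
  import Data.Nat.Properties as ℕ
  open import Data.Nat.Divisibility using (_∣_; divides; ∣m+n∣m⇒∣n; ∣m∣n⇒∣m+n; _∣?_; *-monoʳ-∣; *-cancelˡ-∣; ∣-trans)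
  open import Data.Nat.GCD using (gcd[m,n]∣m; gcd[m,n]∣n; gcd-greatest; gcd-universality)
  open import Data.Nat.Induction using (<-wellFounded)
  open import Data.Nat.Tactic.RingSolver using (solve-∀)
  open import Data.Product using (Σ; _,_; proj₁)
  open import Data.Sum using (_⊎_; inj₁; inj₂)
  open import Function.Bundles using (_⇔_; mk⇔; Equivalence)
  open import Induction.WellFounded using (Acc; acc)
  open import Relation.Nullary using (yes; no)
  open import Relation.Binary.PropositionalEquality

  ∣m+n∣n⇒∣m : ∀ {d m n} → d ∣ m + n → d ∣ n → d ∣ m
  ∣m+n∣n⇒∣m {d} {m} {n} d∣m+n = ∣m+n∣m⇒∣n (subst (d ∣_) (ℕ.+-comm m n) d∣m+n)

  2^k∣r⇒2^suc[k]∣r+r : ∀ {k r} → 2 ^ k ∣ r → 2 ^ suc k ∣ r + r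
  2^k∣r⇒2^suc[k]∣r+r {k} (divides q refl) = divides q (double q (2 ^ k))
    where
    double : ∀ q t → q * t + q * t ≡ q * (2 * t)
    double = solve-∀

  IsE₂-+ˡ : ∀ {k d m} → 2 ^ suc k ∣ d → IsE₂ (d + m) k ⇔ IsE₂ m k
  IsE₂-+ˡ {k} {d} {m} 2ᵏ⁺¹∣d = mk⇔
    (λ { (2ᵏ∣d+m , 2ᵏ⁺¹∤d+m) → ∣m+n∣m⇒∣n 2ᵏ∣d+m 2ᵏ∣d , λ 2ᵏ⁺¹∣m → 2ᵏ⁺¹∤d+m (∣m∣n⇒∣m+n 2ᵏ⁺¹∣d 2ᵏ⁺¹∣m) })
    (λ { (2ᵏ∣m , 2ᵏ⁺¹∤m) → ∣m∣n⇒∣m+n 2ᵏ∣d 2ᵏ∣m , λ 2ᵏ⁺¹∣d+m → 2ᵏ⁺¹∤m (∣m+n∣m⇒∣n 2ᵏ⁺¹∣d+m 2ᵏ⁺¹∣d) })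
    where
    2ᵏ∣d : 2 ^ k ∣ d
    2ᵏ∣d = ∣-trans (divides 2 refl) 2ᵏ⁺¹∣d

  sameE₂-sym : ∀ {m n} → SameE₂ m n → SameE₂ n m
  sameE₂-sym (k , m-E₂ , n-E₂) = k , n-E₂ , m-E₂

  ¬sameE₂-0 : ∀ n → ¬ SameE₂ 0 n
  ¬sameE₂-0 n (k , (_ , 2ᵏ⁺¹∤0) , _) = 2ᵏ⁺¹∤0 (divides 0 refl)

  E₂-exists : ∀ n → Σ ℕ (IsE₂ (suc n))
  E₂-exists n = go n (<-wellFounded n)
    where
    go : ∀ n → Acc _<_ n → Σ ℕ (IsE₂ (suc n))
    go n (acc rs) with 2 ∣? suc n
    ... | no  2∤n = 0 , divides (suc n) (sym (ℕ.*-identityʳ (suc n))) , 2∤n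
    ... | yes (divides (suc q) n≡q*2) with go q (rs q<n)
      where
      q<n : q < n
      q<n = ℕ.≤-pred (subst (suc (suc q) ≤_) (sym n≡q*2) (s≤s (s≤s (ℕ.m≤m*n q 2))))
    ... | k , 2ᵏ∣q , 2ᵏ⁺¹∤q = suc k ,
          subst (2 ^ suc k ∣_) (sym n≡2q) (*-monoʳ-∣ 2 2ᵏ∣q) ,
          λ 2ᵏ⁺²∣n → 2ᵏ⁺¹∤q (*-cancelˡ-∣ 2 (subst (2 * 2 ^ suc k ∣_) n≡2q 2ᵏ⁺²∣n))
      where
      n≡2q : suc n ≡ 2 * suc q
      n≡2q = trans n≡q*2 (ℕ.*-comm (suc q) 2)

  sameE₂-refl : ∀ n → SameE₂ (suc n) (suc n)
  sameE₂-refl n with E₂-exists n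
  ... | k , n-E₂ = k , n-E₂ , n-E₂

  IsE₂-double-+ : ∀ k r s → 2 ^ k ∣ r → IsE₂ (r + (r + s)) k ⇔ IsE₂ s k
  IsE₂-double-+ k r s 2ᵏ∣r =
    subst (λ x → IsE₂ x k ⇔ IsE₂ s k) (ℕ.+-assoc r r s) (IsE₂-+ˡ {k} (2^k∣r⇒2^suc[k]∣r+r {k} 2ᵏ∣r))

  sameE₂-double-+ : ∀ r s → SameE₂ (r + (r + s)) r ⇔ SameE₂ s r
  sameE₂-double-+ r s = mk⇔
    (λ { (k , 2r+s-E₂ , r-E₂) → k , Equivalence.to (IsE₂-double-+ k r s (proj₁ r-E₂)) 2r+s-E₂ , r-E₂ })
    (λ { (k , s-E₂ , r-E₂) → k , Equivalence.from (IsE₂-double-+ k r s (proj₁ r-E₂)) s-E₂ , r-E₂ })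

  sameE₂-+-double-+ : ∀ r s → SameE₂ (r + (r + s)) (r + s) ⇔ SameE₂ (r + s) s
  sameE₂-+-double-+ r s = mk⇔
    (λ { (k , 2r+s-E₂ , r+s-E₂) →
           k , r+s-E₂ , Equivalence.to (IsE₂-double-+ k r s (∣m+n∣n⇒∣m (proj₁ 2r+s-E₂) (proj₁ r+s-E₂))) 2r+s-E₂ })
    (λ { (k , r+s-E₂ , s-E₂) →
           k , Equivalence.from (IsE₂-double-+ k r s (∣m+n∣n⇒∣m (proj₁ r+s-E₂) (proj₁ s-E₂))) s-E₂ , r+s-E₂ })

  gcd-double-+ : ∀ r s → gcd (r + (r + s)) r ≡ gcd s r
  gcd-double-+ r s = sym (gcd-universality
    (λ { (d∣2r+s , d∣r) → gcd-greatest (∣m+n∣m⇒∣n (∣m+n∣m⇒∣n d∣2r+s d∣r) d∣r) d∣r })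
    (λ d∣g → let d∣s = ∣-trans d∣g (gcd[m,n]∣m s r) ; d∣r = ∣-trans d∣g (gcd[m,n]∣n s r)
             in ∣m∣n⇒∣m+n d∣r (∣m∣n⇒∣m+n d∣r d∣s) , d∣r))

  gcd-+-double-+ : ∀ r s → gcd (r + (r + s)) (r + s) ≡ gcd (r + s) s
  gcd-+-double-+ r s = sym (gcd-universality
    (λ { (d∣2r+s , d∣r+s) → gcd-greatest d∣r+s (∣m+n∣m⇒∣n d∣r+s (∣m+n∣n⇒∣m d∣2r+s d∣r+s)) })
    (λ d∣g → let d∣r+s = ∣-trans d∣g (gcd[m,n]∣m (r + s) s) ; d∣s = ∣-trans d∣g (gcd[m,n]∣n (r + s) s)
             in ∣m∣n⇒∣m+n (∣m+n∣n⇒∣m d∣r+s d∣s) d∣r+s , d∣r+s))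

  split-pair : ∀ {m n} → 0 < n → n < m →
    (Σ ℕ λ k → m ≡ n + (n + k) × k + n < m + n) ⊎
    (Σ ℕ λ r → Σ ℕ λ s → m ≡ r + (r + s) × n ≡ r + s × n + s < m + n)
  split-pair {m} {n} 0<n n<m with n ℕ.≤? m ∸ n
  ... | yes n≤r = inj₁ (k , m≡n+n+k , ℕ.+-monoˡ-< n k<m)
    where
    k = m ∸ n ∸ n
    m≡n+n+k : m ≡ n + (n + k)
    m≡n+n+k = trans (sym (ℕ.m+[n∸m]≡n (ℕ.<⇒≤ n<m))) (cong (n +_) (sym (ℕ.m+[n∸m]≡n n≤r)))
    k<m : k < m
    k<m = subst (k <_) (sym m≡n+n+k) (ℕ.<-≤-trans (ℕ.m<n+m k 0<n) (ℕ.m≤n+m (n + k) n))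
  ... | no n≰r = inj₂ (r , s , m≡r+r+s , n≡r+s , subst (n + s <_) (ℕ.+-comm n m) (ℕ.+-monoʳ-< n s<m))
    where
    r = m ∸ n
    s = n ∸ r
    n≡r+s : n ≡ r + s
    n≡r+s = sym (ℕ.m+[n∸m]≡n (ℕ.<⇒≤ (ℕ.≰⇒> n≰r)))
    m≡r+r+s : m ≡ r + (r + s)
    m≡r+r+s = trans (sym (ℕ.m+[n∸m]≡n (ℕ.<⇒≤ n<m))) (trans (ℕ.+-comm n r) (cong (r +_) n≡r+s))
    s<m : s < m
    s<m = ℕ.≤-<-trans (subst (s ≤_) (sym n≡r+s) (ℕ.m≤n+m s r)) n<m

  gcd[n,n]≡n : ∀ n → gcd n n ≡ n
  gcd[n,n]≡n n = sym (gcd-universality proj₁ (λ d∣n → d∣n , d∣n))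

open Polynomial
open Indices

open import Data.Empty using (⊥-elim)
open import Data.Integer using (+_)
open import Data.List using ([])
open import Data.Nat using (zero; suc; _+_; _<_; s≤s; z≤n)
import Data.Nat.Properties as ℕ
open import Data.Nat.GCD using (gcd-comm; gcd-identityˡ)
open import Data.Nat.Induction using (<-wellFounded)
open import Data.Product using (Σ; _,_; proj₁; proj₂; swap)
open import Data.Sum using (inj₁; inj₂)
open import Function.Bundles using (_⇔_; mk⇔; Equivalence)
open import Function.Construct.Composition using (_⇔-∘_)
open import Induction.WellFounded using (Acc; acc)
open import Relation.Binary.Definitions using (tri<; tri≈; tri>)
open import Relation.Binary.PropositionalEquality
open import Tactic.RingSolver using (solve-∀)

module LucasSequence
  (p0 : ℤ) (p1 d g α : Poly) (αp0≋2 : α *P const p0 ≋ const (+ 2)) (αp1≋d : α *P p1 ≋ d) (d⊥g : Coprime d g)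
  where

  Gs : ℕ → Poly
  Gs = G p0 p1 d g

  Gs-≡ : ∀ {m n} → m ≡ n → Gs m ≋ Gs n
  Gs-≡ refl = ≋-refl

  LucasIdentity : ℕ → ℕ → Set
  LucasIdentity n k = α *P (Gs (n + k) *P Gs n) ≋ Gs (n + (n + k)) +P (-P g) ^P n *P Gs k

  lucas-identity-0 : ∀ k → LucasIdentity 0 k
  lucas-identity-0 k = begin
    α *P (Gs k *P const p0)    ≈⟨ rotate α (Gs k) (const p0) ⟩
    (α *P const p0) *P Gs k    ≈⟨ *P-congˡ (Gs k) αp0≋2 ⟩
    const (+ 2) *P Gs k        ≈⟨ double (Gs k) ⟩
    Gs k +P 1P *P Gs k         ∎
    where
    open ≋-Reasoning
    rotate : ∀ a x b → a *P (x *P b) ≋ (a *P b) *P x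
    rotate = solve-∀ ℤ[x]-almost
    double : ∀ x → const (+ 2) *P x ≋ x +P 1P *P x
    double = solve-∀ ℤ[x]-almost

  lucas-identity-1 : ∀ k → LucasIdentity 1 k
  lucas-identity-1 k = begin
    α *P (Gs (suc k) *P p1)                                  ≈⟨ rotate α (Gs (suc k)) p1 ⟩
    (α *P p1) *P Gs (suc k)                                  ≈⟨ *P-congˡ (Gs (suc k)) αp1≋d ⟩
    d *P Gs (suc k)                                          ≈⟨ unfold d g (Gs (suc k)) (Gs k) ⟩
    (d *P Gs (suc k) +P g *P Gs k) +P (-P g *P 1P) *P Gs k   ∎
    where
    open ≋-Reasoning
    rotate : ∀ a x b → a *P (x *P b) ≋ (a *P b) *P x
    rotate = solve-∀ ℤ[x]-almost
    unfold : ∀ d g y x → d *P y ≋ (d *P y +P g *P x) +P (-P g *P 1P) *P x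
    unfold = solve-∀ ℤ[x]-almost

  lucas-identity-+2 : ∀ n k → LucasIdentity (suc n) (suc k) → LucasIdentity n (suc (suc k)) →
                      LucasIdentity (suc (suc n)) k
  lucas-identity-+2 n k ih₁ ih₂ =
    combine α d g (Gs (suc (suc (n + k)))) (Gs n) (Gs (suc n)) (Gs k) (Gs (suc k)) X₁ X₂ ((-P g) ^P n) ih₁′ ih₂′
    where
    open ≋-Reasoning
    X₁ = Gs (suc (n + suc (suc (n + k))))
    X₂ = Gs (n + suc (suc (n + k)))
    n+2+k≡ : n + suc (suc k) ≡ suc (suc (n + k))
    n+2+k≡ = trans (ℕ.+-suc n (suc k)) (cong suc (ℕ.+-suc n k))
    ih₁′ : α *P (Gs (suc (suc (n + k))) *P Gs (suc n)) ≋ X₁ +P (-P g *P (-P g) ^P n) *P Gs (suc k)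
    ih₁′ = begin
      α *P (Gs (suc (suc (n + k))) *P Gs (suc n))         ≈⟨ *P-congʳ α (*P-congˡ (Gs (suc n)) (Gs-≡ (cong suc (ℕ.+-suc n k)))) ⟨
      α *P (Gs (suc n + suc k) *P Gs (suc n))             ≈⟨ ih₁ ⟩
      Gs (suc n + (suc n + suc k)) +P _                   ≈⟨ +P-cong (Gs-≡ (cong (λ i → suc (n + i)) (cong suc (ℕ.+-suc n k)))) ≋-refl ⟩
      X₁ +P (-P g *P (-P g) ^P n) *P Gs (suc k)           ∎
    ih₂′ : α *P (Gs (suc (suc (n + k))) *P Gs n) ≋ X₂ +P (-P g) ^P n *P (d *P Gs (suc k) +P g *P Gs k)
    ih₂′ = begin
      α *P (Gs (suc (suc (n + k))) *P Gs n)               ≈⟨ *P-congʳ α (*P-congˡ (Gs n) (Gs-≡ n+2+k≡)) ⟨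
      α *P (Gs (n + suc (suc k)) *P Gs n)                 ≈⟨ ih₂ ⟩
      Gs (n + (n + suc (suc k))) +P _                     ≈⟨ +P-cong (Gs-≡ (cong (_+_ n) n+2+k≡)) ≋-refl ⟩
      X₂ +P (-P g) ^P n *P (d *P Gs (suc k) +P g *P Gs k) ∎
    combine : ∀ a d g x Gn Gn₁ Gk Gk₁ X₁ X₂ qⁿ →
      a *P (x *P Gn₁) ≋ X₁ +P (-P g *P qⁿ) *P Gk₁ →
      a *P (x *P Gn) ≋ X₂ +P qⁿ *P (d *P Gk₁ +P g *P Gk) →
      a *P (x *P (d *P Gn₁ +P g *P Gn)) ≋ (d *P X₁ +P g *P X₂) +P (-P g *P (-P g *P qⁿ)) *P Gk
    combine a d g x Gn Gn₁ Gk Gk₁ X₁ X₂ qⁿ h₁ h₂ = begin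
      a *P (x *P (d *P Gn₁ +P g *P Gn))
        ≈⟨ distribute a d g x Gn Gn₁ ⟩
      d *P (a *P (x *P Gn₁)) +P g *P (a *P (x *P Gn))
        ≈⟨ +P-cong (*P-congʳ d h₁) (*P-congʳ g h₂) ⟩
      d *P (X₁ +P (-P g *P qⁿ) *P Gk₁) +P g *P (X₂ +P qⁿ *P (d *P Gk₁ +P g *P Gk))
        ≈⟨ collect d g Gk Gk₁ X₁ X₂ qⁿ ⟩
      (d *P X₁ +P g *P X₂) +P (-P g *P (-P g *P qⁿ)) *P Gk ∎
      where
      distribute : ∀ a d g x Gn Gn₁ → a *P (x *P (d *P Gn₁ +P g *P Gn)) ≋ d *P (a *P (x *P Gn₁)) +P g *P (a *P (x *P Gn))
      distribute = solve-∀ ℤ[x]-almost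
      collect : ∀ d g Gk Gk₁ X₁ X₂ qⁿ →
        d *P (X₁ +P (-P g *P qⁿ) *P Gk₁) +P g *P (X₂ +P qⁿ *P (d *P Gk₁ +P g *P Gk)) ≋ (d *P X₁ +P g *P X₂) +P (-P g *P (-P g *P qⁿ)) *P Gk
      collect = solve-∀ ℤ[x]-almost

  lucas-identity : ∀ n k → LucasIdentity n k
  lucas-identity zero          k = lucas-identity-0 k
  lucas-identity (suc zero)    k = lucas-identity-1 k
  lucas-identity (suc (suc n)) k = lucas-identity-+2 n k (lucas-identity (suc n) (suc k)) (lucas-identity n (suc (suc k)))

  Gs-suc-≋ : ∀ j → Σ Poly λ T → Gs (suc j) ≋ d ^P j *P p1 +P g *P T
  Gs-suc-≋ zero    = [] , base p1 g
    where
    base : ∀ p1 g → p1 ≋ 1P *P p1 +P g *P []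
    base = solve-∀ ℤ[x]-almost
  Gs-suc-≋ (suc j) with Gs-suc-≋ j
  ... | T , Gⱼ₊₁≋ = d *P T +P Gs j , ≋-trans (+P-cong (*P-congʳ d Gⱼ₊₁≋) ≋-refl) (regroup d (d ^P j) p1 g T (Gs j))
    where
    regroup : ∀ d dʲ p1 g T Y → d *P (dʲ *P p1 +P g *P T) +P g *P Y ≋ (d *P dʲ) *P p1 +P g *P (d *P T +P Y)
    regroup = solve-∀ ℤ[x]-almost

  ∣Gs-suc⇒coprime-g : ∀ {h} j → h ∣ Gs (suc j) → Coprime h g
  ∣Gs-suc⇒coprime-g {h} j h∣G e e∣h e∣g = d⊥g e e∣d e∣g
    where
    e⊥d : Coprime e d
    e⊥d = coprime-∣ˡ e∣g (coprime-sym d⊥g)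
    e∣dʲp1 : e ∣ d ^P j *P p1
    e∣dʲp1 = ∣-+P-cancelʳ (∣-respʳ (proj₂ (Gs-suc-≋ j)) (∣-trans e∣h h∣G)) (∣-*P-right (proj₁ (Gs-suc-≋ j)) e∣g)
    e∣d : e ∣ d
    e∣d = ∣-respʳ αp1≋d (∣-*P-left α (coprime-∣-^P-cancel j e⊥d e∣dʲp1))

  ∣-lucas-shift : ∀ {h} j r s → h ∣ Gs (suc j) → h ∣ Gs (r + s) *P Gs r → h ∣ Gs (r + (r + s)) ⇔ h ∣ Gs s
  ∣-lucas-shift {h} j r s h∣G h∣GG = mk⇔
    (λ h∣G₂ᵣ₊ₛ → coprime-∣-^P-cancel r h⊥-g (∣-+P-cancelˡ h∣sum h∣G₂ᵣ₊ₛ))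
    (λ h∣Gₛ → ∣-+P-cancelʳ h∣sum (∣-*P-left ((-P g) ^P r) h∣Gₛ))
    where
    h⊥-g : Coprime h (-P g)
    h⊥-g = coprime-negʳ (∣Gs-suc⇒coprime-g j h∣G)
    h∣sum : h ∣ Gs (r + (r + s)) +P (-P g) ^P r *P Gs s
    h∣sum = ∣-respʳ (lucas-identity r s) (∣-*P-left α h∣GG)

  CommonDivisor : ℕ → ℕ → Poly → Set
  CommonDivisor m n h = h ∣ Gs m × h ∣ Gs n

  GcdCharacterisation : ℕ → ℕ → Set
  GcdCharacterisation m n =
    (SameE₂ m n → ∀ h → CommonDivisor m n h ⇔ h ∣ Gs (gcd m n)) ×
    (¬ SameE₂ m n → ∀ h → CommonDivisor m n h ⇔ CommonDivisor (gcd m n) 0 h)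

  characterisation-transfer : ∀ {m n m′ n′} →
    (∀ h → CommonDivisor m n h ⇔ CommonDivisor m′ n′ h) → gcd m n ≡ gcd m′ n′ → SameE₂ m n ⇔ SameE₂ m′ n′ →
    GcdCharacterisation m′ n′ → GcdCharacterisation m n
  characterisation-transfer {m} {n} common≡ gcd≡ sameE₂≡ (same′ , different′) =
    (λ same h → subst (λ x → CommonDivisor m n h ⇔ h ∣ Gs x) (sym gcd≡)
                  (same′ (Equivalence.to sameE₂≡ same) h ⇔-∘ common≡ h)) ,
    (λ different h → subst (λ x → CommonDivisor m n h ⇔ CommonDivisor x 0 h) (sym gcd≡)
                  (different′ (λ same → different (Equivalence.from sameE₂≡ same)) h ⇔-∘ common≡ h))

  characterisation-sym : ∀ {m n} → GcdCharacterisation m n → GcdCharacterisation n m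
  characterisation-sym {m} {n} =
    characterisation-transfer (λ _ → mk⇔ swap swap) (gcd-comm n m) (mk⇔ sameE₂-sym sameE₂-sym)

  characterisation-0 : ∀ n → GcdCharacterisation 0 n
  characterisation-0 n =
    (λ same → ⊥-elim (¬sameE₂-0 n same)) ,
    (λ _ h → subst (λ x → CommonDivisor 0 n h ⇔ CommonDivisor x 0 h) (sym (gcd-identityˡ n)) (mk⇔ swap swap))

  characterisation-diagonal : ∀ n → GcdCharacterisation (suc n) (suc n)
  characterisation-diagonal n =
    (λ _ h → subst (λ x → CommonDivisor (suc n) (suc n) h ⇔ h ∣ Gs x) (sym (gcd[n,n]≡n (suc n))) (mk⇔ proj₁ λ h∣G → h∣G , h∣G)) ,
    (λ different → ⊥-elim (different (sameE₂-refl n)))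

  characterisation-double-+ : ∀ r s → GcdCharacterisation s (suc r) →
                              GcdCharacterisation (suc r + (suc r + s)) (suc r)
  characterisation-double-+ r s = characterisation-transfer common (gcd-double-+ (suc r) s) (sameE₂-double-+ (suc r) s)
    where
    shift : ∀ {h} → h ∣ Gs (suc r) → h ∣ Gs (suc r + (suc r + s)) ⇔ h ∣ Gs s
    shift h∣Gᵣ = ∣-lucas-shift r (suc r) s h∣Gᵣ (∣-*P-left (Gs (suc r + s)) h∣Gᵣ)
    common : ∀ h → CommonDivisor (suc r + (suc r + s)) (suc r) h ⇔ CommonDivisor s (suc r) h
    common h = mk⇔ (λ (h∣G , h∣Gᵣ) → Equivalence.to (shift h∣Gᵣ) h∣G , h∣Gᵣ)
                   (λ (h∣Gₛ , h∣Gᵣ) → Equivalence.from (shift h∣Gᵣ) h∣Gₛ , h∣Gᵣ)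

  characterisation-+-double-+ : ∀ r s j → r + s ≡ suc j → GcdCharacterisation (r + s) s →
                                GcdCharacterisation (r + (r + s)) (r + s)
  characterisation-+-double-+ r s j r+s≡ = characterisation-transfer common (gcd-+-double-+ r s) (sameE₂-+-double-+ r s)
    where
    shift : ∀ {h} → h ∣ Gs (r + s) → h ∣ Gs (r + (r + s)) ⇔ h ∣ Gs s
    shift {h} h∣Gᵣ₊ₛ = ∣-lucas-shift j r s (subst (λ x → h ∣ Gs x) r+s≡ h∣Gᵣ₊ₛ) (∣-*P-right (Gs r) h∣Gᵣ₊ₛ)
    common : ∀ h → CommonDivisor (r + (r + s)) (r + s) h ⇔ CommonDivisor (r + s) s h
    common h = mk⇔ (λ (h∣G , h∣Gᵣ₊ₛ) → h∣Gᵣ₊ₛ , Equivalence.to (shift h∣Gᵣ₊ₛ) h∣G)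
                   (λ (h∣Gᵣ₊ₛ , h∣Gₛ) → Equivalence.from (shift h∣Gᵣ₊ₛ) h∣Gₛ , h∣Gᵣ₊ₛ)

  gcd-characterisation : ∀ m n → GcdCharacterisation m n
  gcd-characterisation m n = go m n (<-wellFounded (m + n))
    where
    reduce : ∀ m n → suc n < m → (∀ {m′ n′} → m′ + n′ < m + suc n → GcdCharacterisation m′ n′) →
             GcdCharacterisation m (suc n)
    reduce m n n<m ih with split-pair (s≤s z≤n) n<m
    ... | inj₁ (k , m≡ , smaller) =
      subst (λ x → GcdCharacterisation x (suc n)) (sym m≡) (characterisation-double-+ n k (ih smaller))
    ... | inj₂ (r , s , m≡ , n≡ , smaller) =
      subst₂ GcdCharacterisation (sym m≡) (sym n≡)
        (characterisation-+-double-+ r s n (sym n≡) (ih (subst (λ x → x + s < m + suc n) n≡ smaller)))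
    go : ∀ m n → Acc _<_ (m + n) → GcdCharacterisation m n
    go zero    n       _        = characterisation-0 n
    go (suc m) zero    _        = characterisation-sym (characterisation-0 (suc m))
    go (suc m) (suc n) (acc rs) with ℕ.<-cmp m n
    ... | tri≈ _ refl _ = characterisation-diagonal m
    ... | tri> _ _ n<m  = reduce (suc m) n (s≤s n<m) (λ smaller → go _ _ (rs smaller))
    ... | tri< m<n _ _  = characterisation-sym
      (reduce (suc n) m (s≤s m<n) (λ {m′} {n′} smaller → go m′ n′ (rs (subst (m′ + n′ <_) (ℕ.+-comm (suc n) (suc m)) smaller))))

theorem15 : (p0 : ℤ) (p1 d g : Poly) → GFPHyp p1 d g → LucasType p0 p1 d g →
    (m n : ℕ) → .{{_ : NonZero m}} → .{{_ : NonZero n}} →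
    (SameE₂ m n → IsGCD (G p0 p1 d g (gcd m n)) (G p0 p1 d g m) (G p0 p1 d g n))
    × (¬ SameE₂ m n → ∀ h → IsGCD h (G p0 p1 d g (gcd m n)) (G p0 p1 d g 0) →
         IsGCD h (G p0 p1 d g m) (G p0 p1 d g n))
theorem15 p0 p1 d g (_ , _ , _ , d⊥g , _) (_ , 2p1≈p0d , ∣p0∣∈[1,2] , _) m n = same-case , different-case
  where
  multiplier = half-multiplier (∣p0∣∈[1,2]⇒p0∣2 p0 ∣p0∣∈[1,2]) (mk≋ 2p1≈p0d)
  open LucasSequence p0 p1 d g (proj₁ multiplier) (proj₁ (proj₂ multiplier)) (proj₂ (proj₂ multiplier))
                     (IsGCD[1]⇒coprime d⊥g)
  same-case : SameE₂ m n → IsGCD (Gs (gcd m n)) (Gs m) (Gs n)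
  same-case same = ∣⇒∣P (proj₁ Ggcd-common) , ∣⇒∣P (proj₂ Ggcd-common) ,
    λ h h∣Gm h∣Gn → ∣⇒∣P (Equivalence.to (common⇔ h) (∣P⇒∣ h∣Gm , ∣P⇒∣ h∣Gn))
    where
    common⇔ = proj₁ (gcd-characterisation m n) same
    Ggcd-common = Equivalence.from (common⇔ (Gs (gcd m n))) (∣-refl _)
  different-case : ¬ SameE₂ m n → ∀ h → IsGCD h (Gs (gcd m n)) (Gs 0) → IsGCD h (Gs m) (Gs n)
  different-case different h (h∣Ggcd , h∣G0 , h-greatest) = ∣⇒∣P (proj₁ h-common) , ∣⇒∣P (proj₂ h-common) ,
    λ h′ h′∣Gm h′∣Gn → let (h′∣Ggcd , h′∣G0) = Equivalence.to (common⇔ h′) (∣P⇒∣ h′∣Gm , ∣P⇒∣ h′∣Gn)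
                       in h-greatest h′ (∣⇒∣P h′∣Ggcd) (∣⇒∣P h′∣G0)
    where
    common⇔ = proj₂ (gcd-characterisation m n) different
    h-common = Equivalence.from (common⇔ h) (∣P⇒∣ h∣Ggcd , ∣P⇒∣ h∣G0)
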